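{- Let $q=p^f$ with $p$ prime, let $V=\mathbb{F}_{q^2}^3$ with the Hermitian form $x_1y_3^q+x_2y_2^q+x_3y_1^q$, and let $\Omega$ be the set of totally isotropic one-dimensional subspaces of $V$, on which $\mathrm{PGU}(3,q)$ acts. Let $h$ be the permutation of $\Omega$ given by $\langle(x_1,x_2,x_3)\rangle^h=\langle(x_1^p,x_2^p,x_3^p)\rangle$. Then for each $g\in\mathrm{PGU}(3,q)$, the permutation $gh^{ -1}$ has at most $p+1$ fixed points on $\Omega$.
   Context: Permutations act on the right, so $gh^{ -1}$ means first $g$ then $h^{ -1}$. -}

module Defs where

open import Level using (Level; _⊔_)
open import Algebra.Bundles using (CommutativeRing)
open import Data.Nat using (ℕ; zero; suc)
open import Data.Fin using (Fin)
import Data.Fin as F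
open import Data.List using (List; length)
open import Data.List.Relation.Unary.Any using (Any)
open import Data.List.Relation.Unary.AllPairs using (AllPairs)
open import Data.Product using (∃; _×_)
open import Relation.Nullary using (¬_)
open import Relation.Binary.Definitions using (Decidable)
open import Relation.Binary.PropositionalEquality using (_≡_)

record IsFiniteFieldOfSize {c ℓ : Level} (R : CommutativeRing c ℓ) (n : ℕ) : Set (c ⊔ ℓ) where
  open CommutativeRing R
  field
    _≟_      : Decidable _≈_
    0≉1      : ¬ (0# ≈ 1#)
    inverse  : ∀ x → ¬ (x ≈ 0#) → ∃ λ y → (x * y) ≈ 1#
    elems    : List Carrier
    complete : ∀ x → Any (x ≈_) elems
    distinct : AllPairs (λ a b → ¬ (a ≈ b)) elems
    size     : length elems ≡ n

module Unitary {c ℓ : Level} (R : CommutativeRing c ℓ) where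
  open CommutativeRing R

  infixr 8 _^ᶠ_
  _^ᶠ_ : Carrier → ℕ → Carrier
  x ^ᶠ zero  = 1#
  x ^ᶠ suc n = x * (x ^ᶠ n)

  V : Set c
  V = Fin 3 → Carrier

  Mat : Set c
  Mat = Fin 3 → Fin 3 → Carrier

  i0 i1 i2 : Fin 3
  i0 = F.zero
  i1 = F.suc F.zero
  i2 = F.suc (F.suc F.zero)

  -- row vector times matrix (permutations/matrices act on the right)
  _·_ : V → Mat → V
  (x · A) j = (x i0 * A i0 j) + ((x i1 * A i1 j) + (x i2 * A i2 j))

  powV : ℕ → V → V
  powV k x i = x i ^ᶠ k

  herm : ℕ → V → V → Carrier
  herm q x y = (x i0 * (y i2 ^ᶠ q)) + ((x i1 * (y i1 ^ᶠ q)) + (x i2 * (y i0 ^ᶠ q)))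

  _≈V_ : V → V → Set ℓ
  x ≈V y = ∀ i → x i ≈ y i

  NonZeroV : V → Set ℓ
  NonZeroV x = ¬ (∀ i → x i ≈ 0#)

  -- ⟨x⟩ = ⟨y⟩ as one-dimensional subspaces (for nonzero x, y)
  SameLine : V → V → Set (c ⊔ ℓ)
  SameLine x y = ∃ λ a → ¬ (a ≈ 0#) × (∀ i → y i ≈ (a * x i))

  IsotropicPoint : ℕ → V → Set ℓ
  IsotropicPoint q x = NonZeroV x × (herm q x x ≈ 0#)

  -- A is in GU(3,q): an isometry of the Hermitian form; its image in
  -- PGU(3,q) acts on points by ⟨x⟩ ↦ ⟨x·A⟩
  IsUnitary : ℕ → Mat → Set (c ⊔ ℓ)
  IsUnitary q A = ∀ x y → herm q (x · A) (y · A) ≈ herm q x y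

-- A fixed point of g h⁻¹ is a point ⟨y⟩ with y isotropic and σ(y) = a·yA, where σ is the p-th
-- power map and τ the q-th power map (the conjugation of the form). Fix one such point ⟨x⟩. Since
-- the form has Witt index one, every other fixed point is non-orthogonal to x, so it has a
-- representative with H(y, x) = 1, and then its scalar a is forced by x. For two such normalised
-- y, z the value t = H(y, z) satisfies σ(t) = κ t with κ = a τ(a) independent of y and z, and
-- t^p = κ t has at most p roots. So if H(·, y₀) separates the normalised points for some y₀, there
-- are at most p of them besides ⟨x⟩. Otherwise H(y, y₀) = H(z, y₀) for two distinct points ⟨y⟩,
-- ⟨z⟩; then d = y − z is anisotropic and orthogonal to x and y₀, every normalised w is
-- y₀ + α(w) x + γ(w) d, and H(·, d) = γ H(d, d) separates the points unless H(w, d) = H(w′, d).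
-- In that case w − w′ = μ x with Tr μ = 0 and σ μ = κ μ, so every α(v) lies in 𝔽ₚ μ and has
-- trace zero, and the norm equation N(γ(v)) H(d, d) + Tr α(v) = 0 gives γ(y) = γ(z) = 0: y = z.

module Submission where

open import Defs
open import Level using (Level; _⊔_)
open import Algebra.Bundles using (CommutativeRing)
open import Data.Nat as ℕ using (ℕ; zero; suc; _≤_; _<_; z≤n; s≤s)
import Data.Nat.Properties as ℕ
open import Data.Nat.Combinatorics using (_C_; nCk+nC[k+1]≡[n+1]C[k+1]; k>n⇒nCk≡0; nC1≡n; nCn≡1)
open import Data.Nat.Divisibility using (_∣_; divides; ∣⇒≤)
open import Data.Nat.Primality using (Prime; euclidsLemma; ¬prime[0]; ¬prime[1]; prime⇒nonTrivial)
open import Data.Nat.Coprimality using (prime⇒coprime; coprime-Bézout)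
open import Data.Nat.GCD using (module Bézout)
open import Data.Fin as Fin using (toℕ; inject₁; fromℕ)
open import Data.Fin.Patterns using (0F; 1F; 2F)
import Data.Fin.Properties as Fin
open import Data.Integer as ℤ using (ℤ; _⊖_)
import Data.Integer.Properties as ℤ
open import Data.Sign as Sign using (Sign)
open import Data.List using (List; []; _∷_; length; foldr; map; filter)
open import Data.List.Properties using (length-map; length-removeAt′; filter-notAll)
open import Data.List.Relation.Unary.Any as Any using (Any; here; there)
open import Data.List.Relation.Unary.All as All using (All; []; _∷_)
open import Data.List.Relation.Unary.All.Properties using (all-filter; ¬Any⇒All¬)
open import Data.List.Relation.Unary.AllPairs as AllPairs using (AllPairs; []; _∷_)
import Data.List.Relation.Unary.AllPairs.Properties as AllPairs
import Data.List.Relation.Unary.All.Properties as All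
open import Data.Maybe using (Maybe; just; nothing)
open import Data.Product using (_×_; _,_; ∃; ∃₂; proj₁; proj₂)
open import Data.Sum using (_⊎_; inj₁; inj₂; [_,_]′)
open import Data.Empty using (⊥; ⊥-elim)
open import Relation.Nullary using (¬_; ¬?; Dec; yes; no)
open import Relation.Binary.Bundles using (Setoid)
open import Function using (id; _∘_)
import Relation.Binary.PropositionalEquality as ≡
import Algebra.Solver.Ring as RingSolver
open import Algebra.Solver.Ring.AlmostCommutativeRing using (_-Raw-AlmostCommutative⟶_; fromCommutativeRing)

[1+k]*[1+n]C[1+k]≡[1+n]*nCk : ∀ n k → suc k ℕ.* (suc n C suc k) ≡.≡ suc n ℕ.* (n C k)
[1+k]*[1+n]C[1+k]≡[1+n]*nCk zero zero = ≡.refl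
[1+k]*[1+n]C[1+k]≡[1+n]*nCk zero (suc k)
  rewrite k>n⇒nCk≡0 {1} {suc (suc k)} (s≤s (s≤s z≤n)) | k>n⇒nCk≡0 {0} {suc k} (s≤s z≤n) = ℕ.*-zeroʳ (suc (suc k))
[1+k]*[1+n]C[1+k]≡[1+n]*nCk (suc n) zero = ≡.trans (ℕ.+-identityʳ _) (≡.trans (nC1≡n (suc (suc n))) (≡.sym (ℕ.*-identityʳ (suc (suc n)))))
[1+k]*[1+n]C[1+k]≡[1+n]*nCk (suc n) (suc k) = begin
  suc (suc k) ℕ.* (suc (suc n) C suc (suc k))    ≡⟨ ≡.cong (suc (suc k) ℕ.*_) (≡.sym (nCk+nC[k+1]≡[n+1]C[k+1] (suc n) (suc k))) ⟩
  suc (suc k) ℕ.* (a ℕ.+ b)                      ≡⟨ ℕ.*-distribˡ-+ (suc (suc k)) a b ⟩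
  a ℕ.+ suc k ℕ.* a ℕ.+ suc (suc k) ℕ.* b        ≡⟨ ℕ.+-assoc a (suc k ℕ.* a) _ ⟩
  a ℕ.+ (suc k ℕ.* a ℕ.+ suc (suc k) ℕ.* b)      ≡⟨ ≡.cong₂ (λ u v → a ℕ.+ (u ℕ.+ v)) ([1+k]*[1+n]C[1+k]≡[1+n]*nCk n k) ([1+k]*[1+n]C[1+k]≡[1+n]*nCk n (suc k)) ⟩
  a ℕ.+ (suc n ℕ.* (n C k) ℕ.+ suc n ℕ.* (n C suc k)) ≡⟨ ≡.cong (a ℕ.+_) (≡.sym (ℕ.*-distribˡ-+ (suc n) (n C k) (n C suc k))) ⟩
  a ℕ.+ suc n ℕ.* (n C k ℕ.+ n C suc k)          ≡⟨ ≡.cong (λ u → a ℕ.+ suc n ℕ.* u) (nCk+nC[k+1]≡[n+1]C[k+1] n k) ⟩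
  suc (suc n) ℕ.* a                              ∎
  where
  open ≡.≡-Reasoning
  a = suc n C suc k
  b = suc n C suc (suc k)

prime∣pCk : ∀ {p k} → Prime p → 0 < k → k < p → p ∣ p C k
prime∣pCk {suc n} {suc k} pr _ k<p
  with euclidsLemma (suc k) (suc n C suc k) pr
         (divides (n C k) (≡.trans ([1+k]*[1+n]C[1+k]≡[1+n]*nCk n k) (ℕ.*-comm (suc n) (n C k))))
... | inj₂ p∣pCk = p∣pCk
... | inj₁ p∣k   = ⊥-elim (ℕ.<⇒≱ k<p (∣⇒≤ p∣k))

module _ {a ℓ} (S : Setoid a ℓ) where
  open Setoid S renaming (Carrier to A)
  open import Data.List.Membership.Setoid S using (_∈_; _─_)
  open import Data.List.Relation.Binary.Permutation.Setoid S using (_↭_; prep; swap; ↭-refl; ↭-sym; ↭-trans)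
  open import Data.List.Relation.Unary.Unique.Setoid S using (Unique)
  open import Data.List.Relation.Binary.Subset.Setoid S using (_⊆_)

  ↭-─ : ∀ {x} m (i : x ∈ m) → m ↭ x ∷ (m ─ i)
  ↭-─ (_ ∷ m) (here x≈y) = prep (sym x≈y) ↭-refl
  ↭-─ (y ∷ m) (there i)  = ↭-trans (prep refl (↭-─ m i)) (swap refl refl ↭-refl)

  ∈-─ : ∀ {x z} m (i : x ∈ m) → z ∈ m → ¬ z ≈ x → z ∈ m ─ i
  ∈-─ (_ ∷ m) (here x≈y) (here z≈y) z≉x = ⊥-elim (z≉x (trans z≈y (sym x≈y)))
  ∈-─ (_ ∷ m) (here _)   (there j)  _   = j
  ∈-─ (_ ∷ m) (there i)  (here z≈y) _   = here z≈y
  ∈-─ (_ ∷ m) (there i)  (there j)  z≉x = there (∈-─ m i j z≉x)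

  unique∧⊆∧≤⇒↭ : ∀ {l m} → Unique l → l ⊆ m → length m ≤ length l → l ↭ m
  unique∧⊆∧≤⇒↭ {[]} {[]} _ _ _ = ↭-refl
  unique∧⊆∧≤⇒↭ {x ∷ l} {m} (x≉l ∷ ul) l⊆m m≤l =
    ↭-trans (prep refl (unique∧⊆∧≤⇒↭ ul l⊆m′ m′≤l)) (↭-sym (↭-─ m x∈m))
    where
    x∈m = l⊆m (here refl)
    l⊆m′ : l ⊆ m ─ x∈m
    l⊆m′ z∈l = ∈-─ m x∈m (l⊆m (there z∈l))
                 (All.lookupWith (λ x≉w z≈w z≈x → x≉w (trans (sym z≈x) z≈w)) x≉l z∈l)
    m′≤l : length (m ─ x∈m) ≤ length l
    m′≤l = ℕ.≤-pred (≡.subst (_≤ suc (length l)) (length-removeAt′ m (Any.index x∈m)) m≤l)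

distinct⊎collision : ∀ {a r e p} {A : Set a} {R : A → A → Set r} {E : A → A → Set e} {P : A → Set p} →
                     (∀ u v → Dec (E u v)) → ∀ {l} → All P l → AllPairs R l →
                     AllPairs (λ u v → ¬ E u v) l ⊎ ∃₂ λ u v → P u × P v × R u v × E u v
distinct⊎collision E? {[]} [] [] = inj₁ []
distinct⊎collision E? {u ∷ l} (Pu ∷ Pl) (Ru ∷ Rl) with Any.any? (E? u) l
... | yes hit = let ((Pv , Ruv) , Euv) = All.lookupAny (All.zip (Pl , Ru)) hit in inj₂ (u , _ , Pu , Pv , Ruv , Euv)
... | no miss with distinct⊎collision E? Pl Rl
...   | inj₁ distinct = inj₁ (¬Any⇒All¬ l miss ∷ distinct)
...   | inj₂ collision = inj₂ collision

module IntegerCoefficientSolver {c ℓ} (R : CommutativeRing c ℓ) where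
  open CommutativeRing R
  open import Algebra.Properties.Ring ring using (-‿involutive; -0#≈0#; -‿distribˡ-*; -‿distribʳ-*; -‿+-comm)
  open import Algebra.Properties.Semiring.Mult semiring using (×-homo-+; ×1-homo-*) renaming (_×_ to _×ₙ_)
  open import Relation.Binary.Reasoning.Setoid setoid

  ⟦_⟧ : ℤ → Carrier
  ⟦ ℤ.+ n ⟧      = n ×ₙ 1#
  ⟦ ℤ.-[1+ n ] ⟧ = - (suc n ×ₙ 1#)

  signed : Sign → Carrier → Carrier
  signed Sign.+ x = x
  signed Sign.- x = - x

  signed-cong : ∀ s {x y} → x ≈ y → signed s x ≈ signed s y
  signed-cong Sign.+ x≈y = x≈y
  signed-cong Sign.- x≈y = -‿cong x≈y

  signed-* : ∀ s t x y → signed (s Sign.* t) (x * y) ≈ signed s x * signed t y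
  signed-* Sign.+ Sign.+ x y = refl
  signed-* Sign.+ Sign.- x y = -‿distribʳ-* x y
  signed-* Sign.- Sign.+ x y = -‿distribˡ-* x y
  signed-* Sign.- Sign.- x y = begin
    x * y         ≈⟨ -‿involutive (x * y) ⟨
    - - (x * y)   ≈⟨ -‿cong (-‿distribˡ-* x y) ⟩
    - (- x * y)   ≈⟨ -‿distribʳ-* (- x) y ⟩
    - x * - y     ∎

  ⟦◃⟧ : ∀ s n → ⟦ s ℤ.◃ n ⟧ ≈ signed s (n ×ₙ 1#)
  ⟦◃⟧ Sign.+ zero    = refl
  ⟦◃⟧ Sign.- zero    = sym -0#≈0#
  ⟦◃⟧ Sign.+ (suc n) = refl
  ⟦◃⟧ Sign.- (suc n) = refl

  ⟦⟧≈signed : ∀ i → ⟦ i ⟧ ≈ signed (ℤ.sign i) (ℤ.∣ i ∣ ×ₙ 1#)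
  ⟦⟧≈signed (ℤ.+ n)      = refl
  ⟦⟧≈signed ℤ.-[1+ n ]   = refl

  *-homo : ∀ i j → ⟦ i ℤ.* j ⟧ ≈ ⟦ i ⟧ * ⟦ j ⟧
  *-homo i j = begin
    ⟦ s ℤ.◃ (ℤ.∣ i ∣ ℕ.* ℤ.∣ j ∣) ⟧                         ≈⟨ ⟦◃⟧ s (ℤ.∣ i ∣ ℕ.* ℤ.∣ j ∣) ⟩
    signed s ((ℤ.∣ i ∣ ℕ.* ℤ.∣ j ∣) ×ₙ 1#)                   ≈⟨ signed-cong s (×1-homo-* ℤ.∣ i ∣ ℤ.∣ j ∣) ⟩
    signed s ((ℤ.∣ i ∣ ×ₙ 1#) * (ℤ.∣ j ∣ ×ₙ 1#))              ≈⟨ signed-* (ℤ.sign i) (ℤ.sign j) _ _ ⟩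
    signed (ℤ.sign i) (ℤ.∣ i ∣ ×ₙ 1#) * signed (ℤ.sign j) (ℤ.∣ j ∣ ×ₙ 1#) ≈⟨ *-cong (⟦⟧≈signed i) (⟦⟧≈signed j) ⟨
    ⟦ i ⟧ * ⟦ j ⟧                                            ∎
    where s = ℤ.sign i Sign.* ℤ.sign j

  -‿homo : ∀ i → ⟦ ℤ.- i ⟧ ≈ - ⟦ i ⟧
  -‿homo (ℤ.+ zero)  = sym -0#≈0#
  -‿homo (ℤ.+ suc n) = refl
  -‿homo ℤ.-[1+ n ]  = sym (-‿involutive _)

  ⊖-homo : ∀ m n → ⟦ m ⊖ n ⟧ ≈ m ×ₙ 1# - n ×ₙ 1#
  ⊖-homo m zero = begin
    ⟦ m ⊖ 0 ⟧        ≡⟨ ≡.cong ⟦_⟧ (ℤ.⊖-≥ {m} {0} z≤n) ⟩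
    m ×ₙ 1#           ≈⟨ +-identityʳ _ ⟨
    m ×ₙ 1# + 0#      ≈⟨ +-congˡ -0#≈0# ⟨
    m ×ₙ 1# - 0#      ∎
  ⊖-homo zero (suc n) = begin
    ⟦ 0 ⊖ suc n ⟧         ≡⟨ ≡.cong ⟦_⟧ (ℤ.⊖-≤ {0} {suc n} z≤n) ⟩
    - (suc n ×ₙ 1#)        ≈⟨ +-identityˡ _ ⟨
    0# - (suc n ×ₙ 1#)     ∎
  ⊖-homo (suc m) (suc n) = begin
    ⟦ suc m ⊖ suc n ⟧                       ≡⟨ ≡.cong ⟦_⟧ (ℤ.[1+m]⊖[1+n]≡m⊖n m n) ⟩
    ⟦ m ⊖ n ⟧                               ≈⟨ ⊖-homo m n ⟩
    m ×ₙ 1# - n ×ₙ 1#                         ≈⟨ x-y≈[1+x]-[1+y] (m ×ₙ 1#) (n ×ₙ 1#) ⟩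
    (1# + m ×ₙ 1#) - (1# + n ×ₙ 1#)           ∎
    where
    x-y≈[1+x]-[1+y] : ∀ x y → x - y ≈ (1# + x) - (1# + y)
    x-y≈[1+x]-[1+y] x y = begin
      x - y                     ≈⟨ +-identityˡ _ ⟨
      0# + (x - y)              ≈⟨ +-congʳ (-‿inverseʳ 1#) ⟨
      (1# - 1#) + (x - y)       ≈⟨ +-assoc 1# (- 1#) (x - y) ⟩
      1# + (- 1# + (x - y))     ≈⟨ +-congˡ (+-assoc (- 1#) x (- y)) ⟨
      1# + ((- 1# + x) - y)     ≈⟨ +-congˡ (+-congʳ (+-comm (- 1#) x)) ⟩
      1# + ((x - 1#) - y)       ≈⟨ +-congˡ (+-assoc x (- 1#) (- y)) ⟩
      1# + (x + (- 1# - y))     ≈⟨ +-assoc 1# x _ ⟨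
      (1# + x) + (- 1# - y)     ≈⟨ +-congˡ (-‿+-comm 1# y) ⟩
      (1# + x) - (1# + y)       ∎

  +-homo : ∀ i j → ⟦ i ℤ.+ j ⟧ ≈ ⟦ i ⟧ + ⟦ j ⟧
  +-homo (ℤ.+ m)    (ℤ.+ n)    = ×-homo-+ 1# m n
  +-homo (ℤ.+ m)    ℤ.-[1+ n ] = ⊖-homo m (suc n)
  +-homo ℤ.-[1+ m ] (ℤ.+ n)    = trans (⊖-homo n (suc m)) (+-comm _ _)
  +-homo ℤ.-[1+ m ] ℤ.-[1+ n ] = begin
    - (suc (suc (m ℕ.+ n)) ×ₙ 1#)             ≈⟨ -‿cong (+-congˡ (trans (+-congˡ (×-homo-+ 1# m n)) (sym (+-assoc _ _ _)))) ⟩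
    - (1# + ((1# + m ×ₙ 1#) + n ×ₙ 1#))        ≈⟨ -‿cong (trans (sym (+-assoc _ _ _)) (trans (+-congʳ (+-comm _ _)) (+-assoc _ _ _))) ⟩
    - ((1# + m ×ₙ 1#) + (1# + n ×ₙ 1#))        ≈⟨ -‿+-comm _ _ ⟨
    - (suc m ×ₙ 1#) - (suc n ×ₙ 1#)            ∎

  homomorphism : ℤ.+-*-rawRing -Raw-AlmostCommutative⟶ fromCommutativeRing R
  homomorphism = record
    { ⟦_⟧    = ⟦_⟧
    ; +-homo = +-homo
    ; *-homo = *-homo
    ; -‿homo = -‿homo
    ; 0-homo = refl
    ; 1-homo = +-identityʳ 1#
    }

  weaklyDecidable : ∀ i j → Maybe (⟦ i ⟧ ≈ ⟦ j ⟧)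
  weaklyDecidable i j with i ℤ.≟ j
  ... | yes ≡.refl = just refl
  ... | no _       = nothing

  open RingSolver ℤ.+-*-rawRing (fromCommutativeRing R) homomorphism weaklyDecidable public
    using (solve; _:+_; _:*_; _:-_; :-_; _:=_)

module CommutativeRingProperties {c ℓ} (R : CommutativeRing c ℓ) where
  open CommutativeRing R
  open Unitary R using (_^ᶠ_)
  open import Algebra.Properties.Ring ring using (-0#≈0#)
  open import Algebra.Properties.CommutativeSemiring.Exp commutativeSemiring
    using (_^_; ^-congˡ; ^-assocʳ; ^-distrib-*)
  open import Algebra.Properties.Semiring.Mult semiring
    using (×-congʳ; ×-congˡ; ×-assoc-*; ×1-homo-*) renaming (_×_ to _×ₙ_)
  open import Algebra.Properties.Semiring.Sum semiring using (sum; sum-init-last; sum-cong-≋; sum-replicate-zero)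
  import Algebra.Properties.CommutativeSemiring.Binomial commutativeSemiring as Binomial
  open import Algebra.Morphism.Structures using (module RingMorphisms)
  open RingMorphisms rawRing rawRing public using (IsRingHomomorphism)
  open IntegerCoefficientSolver R using (solve; _:+_; _:*_; _:-_; :-_; _:=_)
  open import Relation.Binary.Reasoning.Setoid setoid

  ^ᶠ≈^ : ∀ x n → x ^ᶠ n ≈ x ^ n
  ^ᶠ≈^ x zero    = refl
  ^ᶠ≈^ x (suc n) = *-congˡ (^ᶠ≈^ x n)

  ^ᶠ-congˡ : ∀ n {x y} → x ≈ y → x ^ᶠ n ≈ y ^ᶠ n
  ^ᶠ-congˡ n {x} {y} x≈y = trans (^ᶠ≈^ x n) (trans (^-congˡ n x≈y) (sym (^ᶠ≈^ y n)))

  ^ᶠ-assocʳ : ∀ x m n → (x ^ᶠ m) ^ᶠ n ≈ x ^ᶠ (m ℕ.* n)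
  ^ᶠ-assocʳ x m n = begin
    (x ^ᶠ m) ^ᶠ n   ≈⟨ ^ᶠ≈^ (x ^ᶠ m) n ⟩
    (x ^ᶠ m) ^ n    ≈⟨ ^-congˡ n (^ᶠ≈^ x m) ⟩
    (x ^ m) ^ n     ≈⟨ ^-assocʳ x m n ⟩
    x ^ (m ℕ.* n)   ≈⟨ ^ᶠ≈^ x (m ℕ.* n) ⟨
    x ^ᶠ (m ℕ.* n)  ∎

  ^ᶠ-comm : ∀ x m n → (x ^ᶠ m) ^ᶠ n ≈ (x ^ᶠ n) ^ᶠ m
  ^ᶠ-comm x m n = trans (^ᶠ-assocʳ x m n) (trans (reflexive (≡.cong (x ^ᶠ_) (ℕ.*-comm m n))) (sym (^ᶠ-assocʳ x n m)))

  ^ᶠ-distrib-* : ∀ x y n → (x * y) ^ᶠ n ≈ x ^ᶠ n * y ^ᶠ n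
  ^ᶠ-distrib-* x y n = begin
    (x * y) ^ᶠ n      ≈⟨ ^ᶠ≈^ (x * y) n ⟩
    (x * y) ^ n       ≈⟨ ^-distrib-* x y n ⟩
    x ^ n * y ^ n     ≈⟨ *-cong (^ᶠ≈^ x n) (^ᶠ≈^ y n) ⟨
    x ^ᶠ n * y ^ᶠ n   ∎

  1^ᶠn≈1 : ∀ n → 1# ^ᶠ n ≈ 1#
  1^ᶠn≈1 zero    = refl
  1^ᶠn≈1 (suc n) = trans (*-identityˡ _) (1^ᶠn≈1 n)

  ×1-homo-^ : ∀ m k → (m ℕ.^ k) ×ₙ 1# ≈ (m ×ₙ 1#) ^ᶠ k
  ×1-homo-^ m zero    = +-identityʳ 1#
  ×1-homo-^ m (suc k) = trans (×1-homo-* m (m ℕ.^ k)) (*-congˡ (×1-homo-^ m k))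

  ×≈×1* : ∀ n x → n ×ₙ x ≈ (n ×ₙ 1#) * x
  ×≈×1* n x = sym (trans (×-assoc-* n 1# x) (×-congʳ n (*-identityˡ x)))

  ∣⇒×≈0 : ∀ {p m} → p ∣ m → p ×ₙ 1# ≈ 0# → ∀ x → m ×ₙ x ≈ 0#
  ∣⇒×≈0 {p} (divides d ≡.refl) p≈0 x = begin
    (d ℕ.* p) ×ₙ x                  ≈⟨ ×≈×1* (d ℕ.* p) x ⟩
    ((d ℕ.* p) ×ₙ 1#) * x           ≈⟨ *-congʳ (×1-homo-* d p) ⟩
    ((d ×ₙ 1#) * (p ×ₙ 1#)) * x     ≈⟨ *-congʳ (*-congˡ p≈0) ⟩
    ((d ×ₙ 1#) * 0#) * x            ≈⟨ *-congʳ (zeroʳ _) ⟩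
    0# * x                          ≈⟨ zeroˡ x ⟩
    0#                              ∎

  frobenius : ∀ {p} → Prime p → p ×ₙ 1# ≈ 0# → ∀ x y → (x + y) ^ᶠ p ≈ x ^ᶠ p + y ^ᶠ p
  frobenius {0} pr = ⊥-elim (¬prime[0] pr)
  frobenius {1} pr = ⊥-elim (¬prime[1] pr)
  frobenius {n@(suc (suc m))} pr p≈0 x y = begin
    (x + y) ^ᶠ n                                                         ≈⟨ ^ᶠ≈^ (x + y) n ⟩
    (x + y) ^ n                                                          ≈⟨ Binomial.theorem n x y ⟩
    sum t                                                                ≈⟨ +-congˡ (sum-init-last (λ k → t (Fin.suc k))) ⟩
    t 0F + (sum (λ j → t (Fin.suc (inject₁ j))) + t (Fin.suc (fromℕ (suc m))))
      ≈⟨ +-cong first (+-cong (trans (sum-cong-≋ middle) (sum-replicate-zero (suc m))) last) ⟩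
    y ^ᶠ n + (0# + x ^ᶠ n)                                               ≈⟨ +-comm _ _ ⟩
    (0# + x ^ᶠ n) + y ^ᶠ n                                               ≈⟨ +-congʳ (+-identityˡ _) ⟩
    x ^ᶠ n + y ^ᶠ n                                                      ∎
    where
    t = Binomial.binomialTerm x y n

    first : t 0F ≈ y ^ᶠ n
    first = trans (+-identityʳ _) (trans (*-identityˡ _) (sym (^ᶠ≈^ y n)))

    middle : ∀ j → t (Fin.suc (inject₁ j)) ≈ 0#
    middle j = ∣⇒×≈0 (prime∣pCk pr (s≤s z≤n) k<n) p≈0 _
      where
      k<n : suc (toℕ (inject₁ j)) < n
      k<n = s≤s (≡.subst (_< suc m) (≡.sym (Fin.toℕ-inject₁ j)) (Fin.toℕ<n j))

    top : ∀ k → k ≡.≡ n → (n C k) ×ₙ (x ^ k * y ^ (n ℕ.∸ k)) ≈ x ^ᶠ n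
    top k ≡.refl = begin
      (n C n) ×ₙ (x ^ n * y ^ (n ℕ.∸ n))   ≈⟨ ×-congˡ (nCn≡1 n) ⟩
      1 ×ₙ (x ^ n * y ^ (n ℕ.∸ n))         ≈⟨ +-identityʳ _ ⟩
      x ^ n * y ^ (n ℕ.∸ n)                ≡⟨ ≡.cong (λ e → x ^ n * y ^ e) (ℕ.n∸n≡0 n) ⟩
      x ^ n * 1#                           ≈⟨ *-identityʳ _ ⟩
      x ^ n                                ≈⟨ ^ᶠ≈^ x n ⟨
      x ^ᶠ n                               ∎

    last : t (Fin.suc (fromℕ (suc m))) ≈ x ^ᶠ n
    last = top _ (≡.cong suc (Fin.toℕ-fromℕ (suc m)))

  isRingHomomorphism : ∀ {f} → (∀ {x y} → x ≈ y → f x ≈ f y) →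
                       (∀ x y → f (x + y) ≈ f x + f y) → (∀ x y → f (x * y) ≈ f x * f y) →
                       f 1# ≈ 1# → IsRingHomomorphism f
  isRingHomomorphism {f} f-cong +-homo *-homo 1-homo = record
    { isSemiringHomomorphism = record
      { isNearSemiringHomomorphism = record
        { +-isMonoidHomomorphism = record
          { isMagmaHomomorphism = record { isRelHomomorphism = record { cong = f-cong } ; homo = +-homo }
          ; ε-homo = 0-homo
          }
        ; *-homo = *-homo
        }
      ; 1#-homo = 1-homo
      }
    ; -‿homo = -‿homo
    }
    where
    0-homo : f 0# ≈ 0#
    0-homo = begin
      f 0#                   ≈⟨ solve 1 (λ u → u := (u :+ u) :- u) refl (f 0#) ⟩
      (f 0# + f 0#) - f 0#   ≈⟨ +-congʳ (+-homo 0# 0#) ⟨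
      f (0# + 0#) - f 0#     ≈⟨ +-congʳ (f-cong (+-identityˡ 0#)) ⟩
      f 0# - f 0#            ≈⟨ -‿inverseʳ _ ⟩
      0#                     ∎
    -‿homo : ∀ x → f (- x) ≈ - f x
    -‿homo x = begin
      f (- x)                  ≈⟨ solve 2 (λ u v → u := (u :+ v) :- v) refl (f (- x)) (f x) ⟩
      (f (- x) + f x) - f x    ≈⟨ +-congʳ (+-homo (- x) x) ⟨
      f (- x + x) - f x        ≈⟨ +-congʳ (trans (f-cong (-‿inverseˡ x)) 0-homo) ⟩
      0# - f x                 ≈⟨ +-identityˡ _ ⟩
      - f x                    ∎

  module RingHomomorphism {f} (hom : IsRingHomomorphism f) where
    open IsRingHomomorphism hom public

    -‿homo₂ : ∀ x y → f (x - y) ≈ f x - f y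
    -‿homo₂ x y = trans (+-homo x (- y)) (+-congˡ (-‿homo y))

    ×1-homo : ∀ n → f (n ×ₙ 1#) ≈ n ×ₙ 1#
    ×1-homo zero    = 0#-homo
    ×1-homo (suc n) = trans (+-homo 1# (n ×ₙ 1#)) (+-cong 1#-homo (×1-homo n))

  ^ᶠ-isRingHomomorphism : ∀ n → (∀ x y → (x + y) ^ᶠ n ≈ x ^ᶠ n + y ^ᶠ n) → IsRingHomomorphism (_^ᶠ n)
  ^ᶠ-isRingHomomorphism n additive =
    isRingHomomorphism (^ᶠ-congˡ n) additive (λ x y → ^ᶠ-distrib-* x y n) (1^ᶠn≈1 n)

  frobenius-^ : ∀ {p} → Prime p → p ×ₙ 1# ≈ 0# → ∀ k x y →
                (x + y) ^ᶠ (p ℕ.^ k) ≈ x ^ᶠ (p ℕ.^ k) + y ^ᶠ (p ℕ.^ k)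
  frobenius-^ pr p≈0 zero x y =
    trans (*-identityʳ (x + y)) (sym (+-cong (*-identityʳ x) (*-identityʳ y)))
  frobenius-^ {p} pr p≈0 (suc k) x y = begin
    (x + y) ^ᶠ (p ℕ.* p ℕ.^ k)                     ≈⟨ ^ᶠ-assocʳ (x + y) p (p ℕ.^ k) ⟨
    ((x + y) ^ᶠ p) ^ᶠ (p ℕ.^ k)                    ≈⟨ ^ᶠ-congˡ (p ℕ.^ k) (frobenius pr p≈0 x y) ⟩
    (x ^ᶠ p + y ^ᶠ p) ^ᶠ (p ℕ.^ k)                 ≈⟨ frobenius-^ pr p≈0 k (x ^ᶠ p) (y ^ᶠ p) ⟩
    (x ^ᶠ p) ^ᶠ (p ℕ.^ k) + (y ^ᶠ p) ^ᶠ (p ℕ.^ k)  ≈⟨ +-cong (^ᶠ-assocʳ x p (p ℕ.^ k)) (^ᶠ-assocʳ y p (p ℕ.^ k)) ⟩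
    x ^ᶠ (p ℕ.* p ℕ.^ k) + y ^ᶠ (p ℕ.* p ℕ.^ k)    ∎

  sumₗ : List Carrier → Carrier
  sumₗ = foldr _+_ 0#

  productₗ : List Carrier → Carrier
  productₗ = foldr _*_ 1#

  sumₗ-map-+ : ∀ a l → sumₗ (map (a +_) l) ≈ length l ×ₙ a + sumₗ l
  sumₗ-map-+ a []      = sym (+-identityˡ 0#)
  sumₗ-map-+ a (x ∷ l) = begin
    (a + x) + sumₗ (map (a +_) l)         ≈⟨ +-congˡ (sumₗ-map-+ a l) ⟩
    (a + x) + (length l ×ₙ a + sumₗ l)    ≈⟨ solve 4 (λ a x n s → (a :+ x) :+ (n :+ s) := (a :+ n) :+ (x :+ s)) refl a x _ _ ⟩
    (a + length l ×ₙ a) + (x + sumₗ l)    ∎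

  productₗ-map-* : ∀ a l → productₗ (map (a *_) l) ≈ a ^ᶠ length l * productₗ l
  productₗ-map-* a []      = sym (*-identityˡ 1#)
  productₗ-map-* a (x ∷ l) = begin
    (a * x) * productₗ (map (a *_) l)       ≈⟨ *-congˡ (productₗ-map-* a l) ⟩
    (a * x) * (a ^ᶠ length l * productₗ l)  ≈⟨ solve 4 (λ a x n s → (a :* x) :* (n :* s) := (a :* n) :* (x :* s)) refl a x _ _ ⟩
    (a * a ^ᶠ length l) * (x * productₗ l)  ∎

module FiniteField {c ℓ} (R : CommutativeRing c ℓ) {n} (F : IsFiniteFieldOfSize R n) where
  open CommutativeRing R
  open IsFiniteFieldOfSize F
  open Unitary R using (_^ᶠ_)
  open CommutativeRingProperties R
  open IntegerCoefficientSolver R using (solve; _:+_; _:*_; _:-_; :-_; _:=_)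
  open import Algebra.Properties.Semiring.Mult semiring using (×-homo-+) renaming (_×_ to _×ₙ_)
  open import Data.List.Membership.Setoid setoid using (_∈_)
  open import Data.List.Membership.Setoid.Properties using (∈-filter⁺; ∈-map⁻)
  open import Data.List.Relation.Unary.Unique.Setoid setoid using (Unique)
  import Data.List.Relation.Unary.Unique.Setoid.Properties as Unique
  open import Data.List.Relation.Binary.Permutation.Setoid setoid using (_↭_)
  open import Data.List.Relation.Binary.Permutation.Setoid.Properties setoid using (foldr-commMonoid; xs↭ys⇒|xs|≡|ys|)
  open import Relation.Binary.Reasoning.Setoid setoid

  1≉0 : 1# ≉ 0#
  1≉0 1≈0 = 0≉1 (sym 1≈0)

  inv : (x : Carrier) → x ≉ 0# → Carrier
  inv x x≉0 = proj₁ (inverse x x≉0)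

  inverseʳ : ∀ x (x≉0 : x ≉ 0#) → x * inv x x≉0 ≈ 1#
  inverseʳ x x≉0 = proj₂ (inverse x x≉0)

  inverseˡ : ∀ x (x≉0 : x ≉ 0#) → inv x x≉0 * x ≈ 1#
  inverseˡ x x≉0 = trans (*-comm _ _) (inverseʳ x x≉0)

  inv≉0 : ∀ x (x≉0 : x ≉ 0#) → inv x x≉0 ≉ 0#
  inv≉0 x x≉0 x⁻¹≈0 = 1≉0 (begin
    1#               ≈⟨ inverseʳ x x≉0 ⟨
    x * inv x x≉0    ≈⟨ *-congˡ x⁻¹≈0 ⟩
    x * 0#           ≈⟨ zeroʳ x ⟩
    0#               ∎)

  *-cancelˡ : ∀ {a x y} → a ≉ 0# → a * x ≈ a * y → x ≈ y
  *-cancelˡ {a} {x} {y} a≉0 ax≈ay = begin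
    x                        ≈⟨ *-identityˡ x ⟨
    1# * x                   ≈⟨ *-congʳ (inverseˡ a a≉0) ⟨
    (inv a a≉0 * a) * x      ≈⟨ *-assoc _ _ _ ⟩
    inv a a≉0 * (a * x)      ≈⟨ *-congˡ ax≈ay ⟩
    inv a a≉0 * (a * y)      ≈⟨ *-assoc _ _ _ ⟨
    (inv a a≉0 * a) * y      ≈⟨ *-congʳ (inverseˡ a a≉0) ⟩
    1# * y                   ≈⟨ *-identityˡ y ⟩
    y                        ∎

  *-cancelʳ : ∀ {a x y} → a ≉ 0# → x * a ≈ y * a → x ≈ y
  *-cancelʳ a≉0 xa≈ya = *-cancelˡ a≉0 (trans (*-comm _ _) (trans xa≈ya (*-comm _ _)))

  x*y≈0⇒x≈0⊎y≈0 : ∀ {x y} → x * y ≈ 0# → x ≈ 0# ⊎ y ≈ 0#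
  x*y≈0⇒x≈0⊎y≈0 {x} {y} xy≈0 with x ≟ 0#
  ... | yes x≈0 = inj₁ x≈0
  ... | no x≉0  = inj₂ (*-cancelˡ x≉0 (trans xy≈0 (sym (zeroʳ x))))

  x≉0∧y≉0⇒x*y≉0 : ∀ {x y} → x ≉ 0# → y ≉ 0# → x * y ≉ 0#
  x≉0∧y≉0⇒x*y≉0 x≉0 y≉0 xy≈0 = [ x≉0 , y≉0 ]′ (x*y≈0⇒x≈0⊎y≈0 xy≈0)

  x-y≈0⇒x≈y : ∀ {x y} → x - y ≈ 0# → x ≈ y
  x-y≈0⇒x≈y {x} {y} x-y≈0 = begin
    x              ≈⟨ solve 2 (λ x y → x := (x :- y) :+ y) refl x y ⟩
    (x - y) + y    ≈⟨ +-congʳ x-y≈0 ⟩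
    0# + y         ≈⟨ +-identityˡ y ⟩
    y              ∎

  x≈y⇒x-y≈0 : ∀ {x y} → x ≈ y → x - y ≈ 0#
  x≈y⇒x-y≈0 {x} {y} x≈y = trans (+-congʳ x≈y) (-‿inverseʳ y)

  x^ᶠn≉0 : ∀ {x} n → x ≉ 0# → x ^ᶠ n ≉ 0#
  x^ᶠn≉0 zero    x≉0 = 1≉0
  x^ᶠn≉0 (suc n) x≉0 = x≉0∧y≉0⇒x*y≉0 x≉0 (x^ᶠn≉0 n x≉0)

  x^ᶠn≈0⇒x≈0 : ∀ {x} n → x ^ᶠ n ≈ 0# → x ≈ 0#
  x^ᶠn≈0⇒x≈0 {x} n xⁿ≈0 with x ≟ 0#
  ... | yes x≈0 = x≈0
  ... | no x≉0  = ⊥-elim (x^ᶠn≉0 n x≉0 xⁿ≈0)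

  characteristic : n ×ₙ 1# ≈ 0#
  characteristic = begin
    n ×ₙ 1#                             ≈⟨ solve 2 (λ u s → u := (u :+ s) :- s) refl _ s ⟩
    (n ×ₙ 1# + s) - s                   ≡⟨ ≡.cong (λ k → (k ×ₙ 1# + s) - s) (≡.sym size) ⟩
    (length elems ×ₙ 1# + s) - s        ≈⟨ +-congʳ (sumₗ-map-+ 1# elems) ⟨
    sumₗ (map (1# +_) elems) - s        ≈⟨ +-congʳ (foldr-commMonoid +-isCommutativeMonoid shifted↭elems) ⟩
    s - s                               ≈⟨ -‿inverseʳ s ⟩
    0#                                  ∎
    where
    s = sumₗ elems
    shifted↭elems : map (1# +_) elems ↭ elems
    shifted↭elems = unique∧⊆∧≤⇒↭ setoid (Unique.map⁺ setoid setoid +-cancelˡ distinct) (λ {x} _ → complete x)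
                                  (ℕ.≤-reflexive (≡.sym (length-map (1# +_) elems)))
      where
      +-cancelˡ : ∀ {x y} → 1# + x ≈ 1# + y → x ≈ y
      +-cancelˡ {x} {y} 1+x≈1+y = begin
        x                  ≈⟨ solve 2 (λ o x → x := (:- o) :+ (o :+ x)) refl 1# x ⟩
        - 1# + (1# + x)    ≈⟨ +-congˡ 1+x≈1+y ⟩
        - 1# + (1# + y)    ≈⟨ solve 2 (λ o y → (:- o) :+ (o :+ y) := y) refl 1# y ⟩
        y                  ∎

  nonZero? : ∀ x → Dec (x ≉ 0#)
  nonZero? x = ¬? (x ≟ 0#)

  units : List Carrier
  units = filter nonZero? elems

  ≉0-resp-≈ : ∀ {x y} → x ≈ y → x ≉ 0# → y ≉ 0#
  ≉0-resp-≈ x≈y x≉0 y≈0 = x≉0 (trans x≈y y≈0)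

  ∈-units : ∀ {x} → x ≉ 0# → x ∈ units
  ∈-units {x} x≉0 = ∈-filter⁺ setoid nonZero? ≉0-resp-≈ (complete x) x≉0

  units≉0 : All (_≉ 0#) units
  units≉0 = all-filter nonZero? elems

  productₗ≉0 : ∀ {l} → All (_≉ 0#) l → productₗ l ≉ 0#
  productₗ≉0 []           = 1≉0
  productₗ≉0 (x≉0 ∷ l≉0) = x≉0∧y≉0⇒x*y≉0 x≉0 (productₗ≉0 l≉0)

  suc-length-units : suc (length units) ≡.≡ n
  suc-length-units = ≡.trans (≡.sym (xs↭ys⇒|xs|≡|ys| elems↭0∷units)) size
    where
    elems↭0∷units : elems ↭ 0# ∷ units
    elems↭0∷units = unique∧⊆∧≤⇒↭ setoid distinct split
      (filter-notAll nonZero? elems (Any.map (λ 0≈x x≉0 → x≉0 (sym 0≈x)) (complete 0#)))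
      where
      split : ∀ {x} → x ∈ elems → x ∈ 0# ∷ units
      split {x} _ with x ≟ 0#
      ... | yes x≈0 = here x≈0
      ... | no x≉0  = there (∈-units x≉0)

  x^ᶠ|units|≈1 : ∀ {x} → x ≉ 0# → x ^ᶠ length units ≈ 1#
  x^ᶠ|units|≈1 {x} x≉0 = *-cancelʳ (productₗ≉0 units≉0) (begin
    x ^ᶠ length units * productₗ units     ≈⟨ productₗ-map-* x units ⟨
    productₗ (map (x *_) units)            ≈⟨ foldr-commMonoid *-isCommutativeMonoid scaled↭units ⟩
    productₗ units                         ≈⟨ *-identityˡ _ ⟨
    1# * productₗ units                    ∎)
    where
    scaled⊆units : ∀ {z} → z ∈ map (x *_) units → z ∈ units
    scaled⊆units z∈xU with ∈-map⁻ setoid setoid z∈xU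
    ... | y , y∈U , z≈xy = ∈-units (≉0-resp-≈ (sym z≈xy) (x≉0∧y≉0⇒x*y≉0 x≉0 y≉0))
      where y≉0 = All.lookupWith (λ w≉0 y≈w → ≉0-resp-≈ (sym y≈w) w≉0) units≉0 y∈U
    scaled↭units : map (x *_) units ↭ units
    scaled↭units = unique∧⊆∧≤⇒↭ setoid
      (Unique.map⁺ setoid setoid (*-cancelˡ x≉0) (Unique.filter⁺ setoid nonZero? distinct))
      scaled⊆units
      (ℕ.≤-reflexive (≡.sym (length-map (x *_) units)))

  fermat : ∀ x → x ^ᶠ n ≈ x
  fermat x = ≡.subst (λ k → x ^ᶠ k ≈ x) suc-length-units (x*x^ᶠ|units|≈x (x ≟ 0#))
    where
    x*x^ᶠ|units|≈x : Dec (x ≈ 0#) → x * x ^ᶠ length units ≈ x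
    x*x^ᶠ|units|≈x (yes x≈0) = trans (*-congʳ x≈0) (trans (zeroˡ _) (sym x≈0))
    x*x^ᶠ|units|≈x (no x≉0)  = trans (*-congˡ (x^ᶠ|units|≈1 x≉0)) (*-identityʳ x)

  eval : List Carrier → Carrier → Carrier
  eval []       t = 0#
  eval (a ∷ as) t = a + t * eval as t

  divide : Carrier → List Carrier → List Carrier × Carrier
  divide r []                = [] , 0#
  divide r (a ∷ [])          = [] , a
  divide r (a ∷ as@(_ ∷ _)) = let (qs , rm) = divide r as in rm ∷ qs , a + r * rm

  eval-divide : ∀ r cs t → eval cs t ≈ (t - r) * eval (proj₁ (divide r cs)) t + proj₂ (divide r cs)
  eval-divide r []                t = sym (trans (+-identityʳ _) (zeroʳ _))
  eval-divide r (a ∷ [])          t = trans (+-congˡ (zeroʳ t)) (trans (+-comm a 0#) (sym (+-congʳ (zeroʳ _))))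
  eval-divide r (a ∷ as@(_ ∷ _)) t = begin
    a + t * eval as t                      ≈⟨ +-congˡ (*-congˡ (eval-divide r as t)) ⟩
    a + t * ((t - r) * Q + rm)             ≈⟨ solve 5 (λ a t r Q rm → a :+ t :* ((t :- r) :* Q :+ rm)
                                                  := (t :- r) :* (rm :+ t :* Q) :+ (a :+ r :* rm)) refl a t r Q rm ⟩
    (t - r) * (rm + t * Q) + (a + r * rm)  ∎
    where
    Q  = eval (proj₁ (divide r as)) t
    rm = proj₂ (divide r as)

  remainder≈eval : ∀ r cs → proj₂ (divide r cs) ≈ eval cs r
  remainder≈eval r cs = sym (begin
    eval cs r                                          ≈⟨ eval-divide r cs r ⟩
    (r - r) * eval (proj₁ (divide r cs)) r + rm        ≈⟨ +-congʳ (trans (*-congʳ (-‿inverseʳ r)) (zeroˡ _)) ⟩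
    0# + rm                                            ≈⟨ +-identityˡ rm ⟩
    rm                                                 ∎)
    where rm = proj₂ (divide r cs)

  quotient-root : ∀ {r t} cs → eval cs r ≈ 0# → eval cs t ≈ 0# → r ≉ t → eval (proj₁ (divide r cs)) t ≈ 0#
  quotient-root {r} {t} cs cs[r]≈0 cs[t]≈0 r≉t with x*y≈0⇒x≈0⊎y≈0 (begin
      (t - r) * eval (proj₁ (divide r cs)) t                          ≈⟨ +-identityʳ _ ⟨
      (t - r) * eval (proj₁ (divide r cs)) t + 0#                     ≈⟨ +-congˡ (trans (remainder≈eval r cs) cs[r]≈0) ⟨
      (t - r) * eval (proj₁ (divide r cs)) t + proj₂ (divide r cs)    ≈⟨ eval-divide r cs t ⟨
      eval cs t                                                       ≈⟨ cs[t]≈0 ⟩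
      0#                                                              ∎)
  ... | inj₁ t-r≈0 = ⊥-elim (r≉t (sym (x-y≈0⇒x≈y t-r≈0)))
  ... | inj₂ q[t]≈0 = q[t]≈0

  zero-quotient⇒zero : ∀ r cs → All (_≈ 0#) (proj₁ (divide r cs)) → proj₂ (divide r cs) ≈ 0# → All (_≈ 0#) cs
  zero-quotient⇒zero r []                _            _     = []
  zero-quotient⇒zero r (a ∷ [])          []           a≈0   = a≈0 ∷ []
  zero-quotient⇒zero r (a ∷ as@(_ ∷ _)) (rm≈0 ∷ q≈0) rem≈0 =
    trans (sym (trans (+-congˡ (trans (*-congˡ rm≈0) (zeroʳ r))) (+-identityʳ a))) rem≈0
    ∷ zero-quotient⇒zero r as q≈0 rm≈0

  length-quotient : ∀ r a as → length (proj₁ (divide r (a ∷ as))) ≡.≡ length as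
  length-quotient r a []                = ≡.refl
  length-quotient r a (b ∷ [])          = ≡.refl
  length-quotient r a (b ∷ bs@(_ ∷ _)) = ≡.cong suc (length-quotient r b bs)

  roots⇒zero : ∀ {rs} cs → Unique rs → All (λ r → eval cs r ≈ 0#) rs → length cs ≤ length rs → All (_≈ 0#) cs
  roots⇒zero [] _ _ _ = []
  roots⇒zero {r ∷ rs} (a ∷ as) (r≉rs ∷ rs!) (cs[r]≈0 ∷ cs[rs]≈0) (s≤s len) =
    zero-quotient⇒zero r (a ∷ as)
      (roots⇒zero (proj₁ (divide r (a ∷ as))) rs!
        (All.zipWith (λ (r≉t , cs[t]≈0) → quotient-root (a ∷ as) cs[r]≈0 cs[t]≈0 r≉t) (r≉rs , cs[rs]≈0))
        (≡.subst (_≤ length rs) (≡.sym (length-quotient r a as)) len))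
      (trans (remainder≈eval r (a ∷ as)) cs[r]≈0)

  monomial : ℕ → List Carrier
  monomial zero    = 1# ∷ []
  monomial (suc k) = 0# ∷ monomial k

  eval-monomial : ∀ k t → eval (monomial k) t ≈ t ^ᶠ k
  eval-monomial zero    t = trans (+-congˡ (zeroʳ t)) (+-identityʳ 1#)
  eval-monomial (suc k) t = trans (+-identityˡ _) (*-congˡ (eval-monomial k t))

  monomial≉0 : ∀ k → ¬ All (_≈ 0#) (monomial k)
  monomial≉0 zero    (1≈0 ∷ []) = 1≉0 1≈0
  monomial≉0 (suc k) (_ ∷ m≈0)  = monomial≉0 k m≈0

  length-monomial : ∀ k → length (monomial k) ≡.≡ suc k
  length-monomial zero    = ≡.refl
  length-monomial (suc k) = ≡.cong suc (length-monomial k)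

  length-roots[x^m-κx]≤m : ∀ {m} κ rs → 2 ≤ m → Unique rs → All (λ r → r ^ᶠ m ≈ κ * r) rs → length rs ≤ m
  length-roots[x^m-κx]≤m {suc (suc k)} κ rs (s≤s (s≤s _)) rs! roots with length rs ℕ.≤? suc (suc k)
  ... | yes rs≤m = rs≤m
  ... | no rs≰m  = ⊥-elim (poly≉0 (roots⇒zero poly rs! (All.map root roots) poly≤rs))
    where
    poly = 0# ∷ - κ ∷ monomial k
    root : ∀ {t} → t ^ᶠ suc (suc k) ≈ κ * t → eval poly t ≈ 0#
    root {t} tᵐ≈κt = begin
      0# + t * (- κ + t * eval (monomial k) t)   ≈⟨ +-identityˡ _ ⟩
      t * (- κ + t * eval (monomial k) t)        ≈⟨ *-congˡ (+-congˡ (*-congˡ (eval-monomial k t))) ⟩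
      t * (- κ + t * t ^ᶠ k)                     ≈⟨ solve 3 (λ t κ u → t :* (:- κ :+ t :* u) := t :* (t :* u) :- κ :* t) refl t κ (t ^ᶠ k) ⟩
      t ^ᶠ suc (suc k) - κ * t                   ≈⟨ x≈y⇒x-y≈0 tᵐ≈κt ⟩
      0#                                         ∎
    poly≉0 : ¬ All (_≈ 0#) poly
    poly≉0 (_ ∷ _ ∷ m≈0) = monomial≉0 k m≈0
    poly≤rs : length poly ≤ length rs
    poly≤rs = ≡.subst (_≤ length rs) (≡.sym (≡.cong (λ l → suc (suc l)) (length-monomial k))) (ℕ.≰⇒> rs≰m)

  module PrimeSubfield {p} (p-prime : Prime p) (p≈0 : p ×ₙ 1# ≈ 0#) where

    σ-isRingHomomorphism : IsRingHomomorphism (_^ᶠ p)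
    σ-isRingHomomorphism = ^ᶠ-isRingHomomorphism p (frobenius p-prime p≈0)

    module σ = RingHomomorphism σ-isRingHomomorphism

    2≤p : 2 ≤ p
    2≤p = ℕ.nonTrivial⇒n>1 p {{prime⇒nonTrivial p-prime}}

    1+kb≢la : ∀ {a b k l} → a ×ₙ 1# ≈ 0# → b ×ₙ 1# ≈ 0# → ¬ 1 ℕ.+ k ℕ.* b ≡.≡ l ℕ.* a
    1+kb≢la {a} {b} {k} {l} a≈0 b≈0 eq = 1≉0 (begin
      1#                        ≈⟨ +-identityʳ 1# ⟨
      1# + 0#                   ≈⟨ +-congˡ (∣⇒×≈0 (divides k ≡.refl) b≈0 1#) ⟨
      (1 ℕ.+ k ℕ.* b) ×ₙ 1#     ≡⟨ ≡.cong (_×ₙ 1#) eq ⟩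
      (l ℕ.* a) ×ₙ 1#           ≈⟨ ∣⇒×≈0 (divides l ≡.refl) a≈0 1# ⟩
      0#                        ∎)

    m×1≉0 : ∀ {m} → 0 < m → m < p → m ×ₙ 1# ≉ 0#
    m×1≉0 {m@(suc _)} _ m<p m≈0 with coprime-Bézout (prime⇒coprime p-prime m<p)
    ... | Bézout.+- x y eq = 1+kb≢la {p} {m} {y} {x} p≈0 m≈0 eq
    ... | Bézout.-+ x y eq = 1+kb≢la {m} {p} {x} {y} m≈0 p≈0 eq

    i×1≉j×1 : ∀ {i j} → i < j → j < p → i ×ₙ 1# ≉ j ×ₙ 1#
    i×1≉j×1 {i} {j} i<j j<p i≈j = m×1≉0 (ℕ.m<n⇒0<n∸m i<j) (ℕ.≤-<-trans (ℕ.m∸n≤m j i) j<p) (begin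
      (j ℕ.∸ i) ×ₙ 1#                          ≈⟨ solve 2 (λ a b → a := (b :+ a) :- b) refl _ (i ×ₙ 1#) ⟩
      (i ×ₙ 1# + (j ℕ.∸ i) ×ₙ 1#) - i ×ₙ 1#    ≈⟨ +-congʳ (×-homo-+ 1# i (j ℕ.∸ i)) ⟨
      (i ℕ.+ (j ℕ.∸ i)) ×ₙ 1# - i ×ₙ 1#        ≡⟨ ≡.cong (λ k → k ×ₙ 1# - i ×ₙ 1#) (ℕ.m+[n∸m]≡n (ℕ.<⇒≤ i<j)) ⟩
      j ×ₙ 1# - i ×ₙ 1#                        ≈⟨ x≈y⇒x-y≈0 (sym i≈j) ⟩
      0#                                       ∎)

    multiples : ℕ → List Carrier
    multiples zero    = []
    multiples (suc k) = k ×ₙ 1# ∷ multiples k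

    length-multiples : ∀ k → length (multiples k) ≡.≡ k
    length-multiples zero    = ≡.refl
    length-multiples (suc k) = ≡.cong suc (length-multiples k)

    all-multiples : ∀ {P : Carrier → Set ℓ} k → (∀ i → i < k → P (i ×ₙ 1#)) → All P (multiples k)
    all-multiples zero    _ = []
    all-multiples (suc k) P = P k ℕ.≤-refl ∷ all-multiples k (λ i i<k → P i (ℕ.m<n⇒m<1+n i<k))

    ∈-multiples⁻ : ∀ {t} k → t ∈ multiples k → ∃ λ i → t ≈ i ×ₙ 1#
    ∈-multiples⁻ (suc k) (here t≈k) = k , t≈k
    ∈-multiples⁻ (suc k) (there t∈) = ∈-multiples⁻ k t∈

    multiples! : ∀ k → k ≤ p → Unique (multiples k)
    multiples! zero    _   = []
    multiples! (suc k) k<p =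
      all-multiples k (λ i i<k k≈i → i×1≉j×1 i<k k<p (sym k≈i)) ∷ multiples! k (ℕ.<⇒≤ k<p)

    σ-fixed⇒multiple : ∀ {t} → t ^ᶠ p ≈ t → ∃ λ k → t ≈ k ×ₙ 1#
    σ-fixed⇒multiple {t} tᵖ≈t with Any.any? (t ≟_) (multiples p)
    ... | yes t∈ = ∈-multiples⁻ p t∈
    ... | no t∉  = ⊥-elim (ℕ.<-irrefl ≡.refl (≡.subst (λ k → suc k ≤ p) (length-multiples p)
          (length-roots[x^m-κx]≤m 1# (t ∷ multiples p) 2≤p
            (¬Any⇒All¬ _ t∉ ∷ multiples! p ℕ.≤-refl)
            (trans tᵖ≈t (sym (*-identityˡ t)) ∷ all-multiples p (λ i _ → trans (σ.×1-homo i) (sym (*-identityˡ _)))))))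

    eigenvector⇒prime-multiple : ∀ {κ μ α} → μ ≉ 0# → μ ^ᶠ p ≈ κ * μ → α ^ᶠ p ≈ κ * α → ∃ λ k → α ≈ k ×ₙ 1# * μ
    eigenvector⇒prime-multiple {κ} {μ} {α} μ≉0 μᵖ≈κμ αᵖ≈κα = k , (begin
      α              ≈⟨ tμ≈α ⟨
      t * μ          ≈⟨ *-congʳ t≈k ⟩
      k ×ₙ 1# * μ    ∎)
      where
      t = α * inv μ μ≉0
      tμ≈α : t * μ ≈ α
      tμ≈α = trans (*-assoc _ _ _) (trans (*-congˡ (inverseˡ μ μ≉0)) (*-identityʳ α))
      κ≉0 : κ ≉ 0#
      κ≉0 κ≈0 = x^ᶠn≉0 p μ≉0 (trans μᵖ≈κμ (trans (*-congʳ κ≈0) (zeroˡ μ)))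
      tᵖ≈t : t ^ᶠ p ≈ t
      tᵖ≈t = *-cancelʳ (x≉0∧y≉0⇒x*y≉0 κ≉0 μ≉0) (begin
        t ^ᶠ p * (κ * μ)     ≈⟨ *-congˡ μᵖ≈κμ ⟨
        t ^ᶠ p * μ ^ᶠ p      ≈⟨ σ.*-homo t μ ⟨
        (t * μ) ^ᶠ p         ≈⟨ σ.⟦⟧-cong tμ≈α ⟩
        α ^ᶠ p               ≈⟨ αᵖ≈κα ⟩
        κ * α                ≈⟨ *-congˡ tμ≈α ⟨
        κ * (t * μ)          ≈⟨ solve 3 (λ k t m → k :* (t :* m) := t :* (k :* m)) refl κ t μ ⟩
        t * (κ * μ)          ∎)
      k = proj₁ (σ-fixed⇒multiple tᵖ≈t)
      t≈k = proj₂ (σ-fixed⇒multiple tᵖ≈t)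

module HermitianForm {c ℓ} (R : CommutativeRing c ℓ) {n} (F : IsFiniteFieldOfSize R n) (q : ℕ)
  (τ-isRingHomomorphism : CommutativeRingProperties.IsRingHomomorphism R (λ x → Unitary._^ᶠ_ R x q))
  (τ-involutive : ∀ x → CommutativeRing._≈_ R (Unitary._^ᶠ_ R (Unitary._^ᶠ_ R x q) q) x) where

  open CommutativeRing R
  open Unitary R
  open CommutativeRingProperties R using (IsRingHomomorphism; module RingHomomorphism)

  open IsFiniteFieldOfSize F using (_≟_)
  open FiniteField R F
  open IntegerCoefficientSolver R using (solve; _:+_; _:*_; _:-_; :-_; _:=_)
  open import Algebra.Properties.Ring ring using (-‿involutive; -0#≈0#)
  open import Relation.Binary.Reasoning.Setoid setoid

  τ : Carrier → Carrier
  τ x = x ^ᶠ q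

  module τ = RingHomomorphism τ-isRingHomomorphism

  τ-injective : ∀ {x y} → τ x ≈ τ y → x ≈ y
  τ-injective {x} {y} τx≈τy = trans (sym (τ-involutive x)) (trans (τ.⟦⟧-cong τx≈τy) (τ-involutive y))

  τx≈0⇒x≈0 : ∀ {x} → τ x ≈ 0# → x ≈ 0#
  τx≈0⇒x≈0 τx≈0 = τ-injective (trans τx≈0 (sym τ.0#-homo))

  infixl 6 _⊕_ _⊝_
  infixr 7 _⊛_

  _⊕_ : V → V → V
  (u ⊕ v) i = u i + v i

  _⊝_ : V → V → V
  (u ⊝ v) i = u i - v i

  _⊛_ : Carrier → V → V
  (k ⊛ u) i = k * u i

  _∈⟨_⟩ : V → V → Set (c ⊔ ℓ)
  u ∈⟨ w ⟩ = ∃ λ s → u ≈V (s ⊛ w)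

  ≈V-refl : ∀ {u} → u ≈V u
  ≈V-refl i = refl

  ≈V-sym : ∀ {u v} → u ≈V v → v ≈V u
  ≈V-sym u≈v i = sym (u≈v i)

  H : V → V → Carrier
  H = herm q

  H-cong : ∀ {u u′ v v′} → u ≈V u′ → v ≈V v′ → H u v ≈ H u′ v′
  H-cong u≈ v≈ = +-cong (*-cong (u≈ i0) (τ.⟦⟧-cong (v≈ i2)))
                   (+-cong (*-cong (u≈ i1) (τ.⟦⟧-cong (v≈ i1))) (*-cong (u≈ i2) (τ.⟦⟧-cong (v≈ i0))))

  H-congˡ : ∀ {u u′} v → u ≈V u′ → H u v ≈ H u′ v
  H-congˡ v u≈ = H-cong u≈ (≈V-refl {v})

  H-distribʳ-⊕ : ∀ u v w → H (u ⊕ v) w ≈ H u w + H v w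
  H-distribʳ-⊕ u v w = solve 9 (λ u₀ u₁ u₂ v₀ v₁ v₂ a b c →
      (u₀ :+ v₀) :* c :+ ((u₁ :+ v₁) :* b :+ (u₂ :+ v₂) :* a)
      := (u₀ :* c :+ (u₁ :* b :+ u₂ :* a)) :+ (v₀ :* c :+ (v₁ :* b :+ v₂ :* a)))
    refl (u i0) (u i1) (u i2) (v i0) (v i1) (v i2) (τ (w i0)) (τ (w i1)) (τ (w i2))

  H-distribʳ-⊝ : ∀ u v w → H (u ⊝ v) w ≈ H u w - H v w
  H-distribʳ-⊝ u v w = solve 9 (λ u₀ u₁ u₂ v₀ v₁ v₂ a b c →
      (u₀ :- v₀) :* c :+ ((u₁ :- v₁) :* b :+ (u₂ :- v₂) :* a)
      := (u₀ :* c :+ (u₁ :* b :+ u₂ :* a)) :- (v₀ :* c :+ (v₁ :* b :+ v₂ :* a)))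
    refl (u i0) (u i1) (u i2) (v i0) (v i1) (v i2) (τ (w i0)) (τ (w i1)) (τ (w i2))

  H-⊛ˡ : ∀ k u w → H (k ⊛ u) w ≈ k * H u w
  H-⊛ˡ k u w = solve 7 (λ k u₀ u₁ u₂ a b c →
      (k :* u₀) :* c :+ ((k :* u₁) :* b :+ (k :* u₂) :* a) := k :* (u₀ :* c :+ (u₁ :* b :+ u₂ :* a)))
    refl k (u i0) (u i1) (u i2) (τ (w i0)) (τ (w i1)) (τ (w i2))

  H-distribˡ-⊕ : ∀ u v w → H u (v ⊕ w) ≈ H u v + H u w
  H-distribˡ-⊕ u v w = begin
    H u (v ⊕ w)
      ≈⟨ +-cong (*-congˡ (τ.+-homo _ _)) (+-cong (*-congˡ (τ.+-homo _ _)) (*-congˡ (τ.+-homo _ _))) ⟩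
    u i0 * (τ (v i2) + τ (w i2)) + (u i1 * (τ (v i1) + τ (w i1)) + u i2 * (τ (v i0) + τ (w i0)))
      ≈⟨ solve 9 (λ u₀ u₁ u₂ a b c d e f →
           u₀ :* (c :+ f) :+ (u₁ :* (b :+ e) :+ u₂ :* (a :+ d))
           := (u₀ :* c :+ (u₁ :* b :+ u₂ :* a)) :+ (u₀ :* f :+ (u₁ :* e :+ u₂ :* d)))
         refl (u i0) (u i1) (u i2) (τ (v i0)) (τ (v i1)) (τ (v i2)) (τ (w i0)) (τ (w i1)) (τ (w i2)) ⟩
    H u v + H u w
      ∎

  H-⊛ʳ : ∀ k u w → H u (k ⊛ w) ≈ τ k * H u w
  H-⊛ʳ k u w = begin
    H u (k ⊛ w)
      ≈⟨ +-cong (*-congˡ (τ.*-homo _ _)) (+-cong (*-congˡ (τ.*-homo _ _)) (*-congˡ (τ.*-homo _ _))) ⟩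
    u i0 * (τ k * τ (w i2)) + (u i1 * (τ k * τ (w i1)) + u i2 * (τ k * τ (w i0)))
      ≈⟨ solve 7 (λ k u₀ u₁ u₂ a b c →
           u₀ :* (k :* c) :+ (u₁ :* (k :* b) :+ u₂ :* (k :* a)) := k :* (u₀ :* c :+ (u₁ :* b :+ u₂ :* a)))
         refl (τ k) (u i0) (u i1) (u i2) (τ (w i0)) (τ (w i1)) (τ (w i2)) ⟩
    τ k * H u w
      ∎

  H-conjugate : ∀ u v → H v u ≈ τ (H u v)
  H-conjugate u v = sym (begin
    τ (H u v)
      ≈⟨ trans (τ.+-homo _ _) (+-congˡ (τ.+-homo _ _)) ⟩
    τ (u i0 * τ (v i2)) + (τ (u i1 * τ (v i1)) + τ (u i2 * τ (v i0)))
      ≈⟨ +-cong (τ.*-homo _ _) (+-cong (τ.*-homo _ _) (τ.*-homo _ _)) ⟩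
    τ (u i0) * τ (τ (v i2)) + (τ (u i1) * τ (τ (v i1)) + τ (u i2) * τ (τ (v i0)))
      ≈⟨ +-cong (*-congˡ (τ-involutive _)) (+-cong (*-congˡ (τ-involutive _)) (*-congˡ (τ-involutive _))) ⟩
    τ (u i0) * v i2 + (τ (u i1) * v i1 + τ (u i2) * v i0)
      ≈⟨ solve 6 (λ a b c d e f → a :* f :+ (b :* e :+ c :* d) := d :* c :+ (e :* b :+ f :* a))
           refl (τ (u i0)) (τ (u i1)) (τ (u i2)) (v i0) (v i1) (v i2) ⟩
    H v u
      ∎)

  H≈0-sym : ∀ u v → H u v ≈ 0# → H v u ≈ 0#
  H≈0-sym u v Huv≈0 = trans (H-conjugate u v) (trans (τ.⟦⟧-cong Huv≈0) τ.0#-homo)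

  H≈1-sym : ∀ u v → H u v ≈ 1# → H v u ≈ 1#
  H≈1-sym u v Huv≈1 = trans (H-conjugate u v) (trans (τ.⟦⟧-cong Huv≈1) τ.1#-homo)

  dot : V → V → Carrier
  dot u v = u i0 * v i0 + (u i1 * v i1 + u i2 * v i2)

  cross : V → V → V
  cross u v 0F = u i1 * v i2 - u i2 * v i1
  cross u v 1F = u i2 * v i0 - u i0 * v i2
  cross u v 2F = u i0 * v i1 - u i1 * v i0

  -- H u x = dot u (J x)
  J : V → V
  J x 0F = τ (x i2)
  J x 1F = τ (x i1)
  J x 2F = τ (x i0)

  zero⊎nonzero-coordinate : ∀ (w : V) → (∀ i → w i ≈ 0#) ⊎ ∃ λ i → w i ≉ 0#
  zero⊎nonzero-coordinate w with w i0 ≟ 0# | w i1 ≟ 0# | w i2 ≟ 0#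
  ... | no w₀≉0 | _       | _       = inj₂ (i0 , w₀≉0)
  ... | yes _   | no w₁≉0 | _       = inj₂ (i1 , w₁≉0)
  ... | yes _   | yes _   | no w₂≉0 = inj₂ (i2 , w₂≉0)
  ... | yes w₀≈0 | yes w₁≈0 | yes w₂≈0 = inj₁ λ { 0F → w₀≈0 ; 1F → w₁≈0 ; 2F → w₂≈0 }

  dot-comm : ∀ u v → dot u v ≈ dot v u
  dot-comm u v = +-cong (*-comm _ _) (+-cong (*-comm _ _) (*-comm _ _))

  dot-zeroʳ : ∀ u {v : V} → (∀ i → v i ≈ 0#) → dot u v ≈ 0#
  dot-zeroʳ u v≈0 = trans (+-cong (*-zero (v≈0 i0)) (+-cong (*-zero (v≈0 i1)) (*-zero (v≈0 i2))))
                          (trans (+-identityˡ _) (+-identityˡ 0#))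
    where
    *-zero : ∀ {x y} → y ≈ 0# → x * y ≈ 0#
    *-zero y≈0 = trans (*-congˡ y≈0) (zeroʳ _)

  dot-cross : ∀ x y a b → dot (cross x y) (cross a b) ≈ dot x a * dot y b - dot x b * dot y a
  dot-cross x y a b = solve 12 (λ x₀ x₁ x₂ y₀ y₁ y₂ a₀ a₁ a₂ b₀ b₁ b₂ →
      (x₁ :* y₂ :- x₂ :* y₁) :* (a₁ :* b₂ :- a₂ :* b₁)
        :+ ((x₂ :* y₀ :- x₀ :* y₂) :* (a₂ :* b₀ :- a₀ :* b₂) :+ (x₀ :* y₁ :- x₁ :* y₀) :* (a₀ :* b₁ :- a₁ :* b₀))
      := (x₀ :* a₀ :+ (x₁ :* a₁ :+ x₂ :* a₂)) :* (y₀ :* b₀ :+ (y₁ :* b₁ :+ y₂ :* b₂))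
         :- (x₀ :* b₀ :+ (x₁ :* b₁ :+ x₂ :* b₂)) :* (y₀ :* a₀ :+ (y₁ :* a₁ :+ y₂ :* a₂)))
    refl (x i0) (x i1) (x i2) (y i0) (y i1) (y i2) (a i0) (a i1) (a i2) (b i0) (b i1) (b i2)

  cross-cross : ∀ a b u i → cross (cross a b) u i ≈ dot u a * b i - dot u b * a i
  cross-cross a b u 0F = solve 9 (λ a₀ a₁ a₂ b₀ b₁ b₂ u₀ u₁ u₂ →
      (a₂ :* b₀ :- a₀ :* b₂) :* u₂ :- (a₀ :* b₁ :- a₁ :* b₀) :* u₁
      := (u₀ :* a₀ :+ (u₁ :* a₁ :+ u₂ :* a₂)) :* b₀ :- (u₀ :* b₀ :+ (u₁ :* b₁ :+ u₂ :* b₂)) :* a₀)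
    refl (a i0) (a i1) (a i2) (b i0) (b i1) (b i2) (u i0) (u i1) (u i2)
  cross-cross a b u 1F = solve 9 (λ a₀ a₁ a₂ b₀ b₁ b₂ u₀ u₁ u₂ →
      (a₀ :* b₁ :- a₁ :* b₀) :* u₀ :- (a₁ :* b₂ :- a₂ :* b₁) :* u₂
      := (u₀ :* a₀ :+ (u₁ :* a₁ :+ u₂ :* a₂)) :* b₁ :- (u₀ :* b₀ :+ (u₁ :* b₁ :+ u₂ :* b₂)) :* a₁)
    refl (a i0) (a i1) (a i2) (b i0) (b i1) (b i2) (u i0) (u i1) (u i2)
  cross-cross a b u 2F = solve 9 (λ a₀ a₁ a₂ b₀ b₁ b₂ u₀ u₁ u₂ →
      (a₁ :* b₂ :- a₂ :* b₁) :* u₁ :- (a₂ :* b₀ :- a₀ :* b₂) :* u₀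
      := (u₀ :* a₀ :+ (u₁ :* a₁ :+ u₂ :* a₂)) :* b₂ :- (u₀ :* b₀ :+ (u₁ :* b₁ :+ u₂ :* b₂)) :* a₂)
    refl (a i0) (a i1) (a i2) (b i0) (b i1) (b i2) (u i0) (u i1) (u i2)

  cross≈0⇒∈⟨⟩ : ∀ {w u : V} → NonZeroV w → (∀ i → cross w u i ≈ 0#) → u ∈⟨ w ⟩
  cross≈0⇒∈⟨⟩ {w} {u} w≉0 w×u≈0 with zero⊎nonzero-coordinate w
  ... | inj₁ w≈0 = ⊥-elim (w≉0 w≈0)
  ... | inj₂ (i , wᵢ≉0) = u i * inv (w i) wᵢ≉0 , λ j → *-cancelˡ wᵢ≉0 (begin
    w i * u j                                   ≈⟨ proportional i j ⟩
    w j * u i                                   ≈⟨ *-identityˡ _ ⟨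
    1# * (w j * u i)                            ≈⟨ *-congʳ (inverseʳ (w i) wᵢ≉0) ⟨
    (w i * inv (w i) wᵢ≉0) * (w j * u i)        ≈⟨ solve 4 (λ wj ui wi w⁻¹ → (wi :* w⁻¹) :* (wj :* ui) := wi :* ((ui :* w⁻¹) :* wj))
                                                     refl (w j) (u i) (w i) (inv (w i) wᵢ≉0) ⟩
    w i * ((u i * inv (w i) wᵢ≉0) * w j)        ∎)
    where
    e₀ : w i1 * u i2 ≈ w i2 * u i1
    e₀ = x-y≈0⇒x≈y (w×u≈0 i0)
    e₁ : w i2 * u i0 ≈ w i0 * u i2
    e₁ = x-y≈0⇒x≈y (w×u≈0 i1)
    e₂ : w i0 * u i1 ≈ w i1 * u i0
    e₂ = x-y≈0⇒x≈y (w×u≈0 i2)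
    proportional : ∀ i j → w i * u j ≈ w j * u i
    proportional 0F 0F = refl
    proportional 0F 1F = e₂
    proportional 0F 2F = sym e₁
    proportional 1F 0F = sym e₂
    proportional 1F 1F = refl
    proportional 1F 2F = e₀
    proportional 2F 0F = e₁
    proportional 2F 1F = sym e₀
    proportional 2F 2F = refl

  dot-orthogonal⇒∈⟨cross⟩ : ∀ {a b u : V} → NonZeroV (cross a b) → dot u a ≈ 0# → dot u b ≈ 0# → u ∈⟨ cross a b ⟩
  dot-orthogonal⇒∈⟨cross⟩ {a} {b} {u} a×b≉0 u·a≈0 u·b≈0 = cross≈0⇒∈⟨⟩ a×b≉0 λ i → begin
    cross (cross a b) u i          ≈⟨ cross-cross a b u i ⟩
    dot u a * b i - dot u b * a i  ≈⟨ +-cong (*-congʳ u·a≈0) (-‿cong (*-congʳ u·b≈0)) ⟩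
    0# * b i - 0# * a i            ≈⟨ +-cong (zeroˡ _) (trans (-‿cong (zeroˡ _)) -0#≈0#) ⟩
    0# + 0#                        ≈⟨ +-identityˡ 0# ⟩
    0#                             ∎

  multiple-coefficient≉0 : ∀ {s} {w u : V} → NonZeroV u → u ≈V (s ⊛ w) → s ≉ 0#
  multiple-coefficient≉0 u≉0 u≈sw s≈0 = u≉0 (λ i → trans (u≈sw i) (trans (*-congʳ s≈0) (zeroˡ _)))

  ∈⟨⟩-rebase : ∀ {u v w : V} {s} → s ≉ 0# → u ≈V (s ⊛ w) → v ∈⟨ w ⟩ → v ∈⟨ u ⟩
  ∈⟨⟩-rebase {u} {v} {w} {s} s≉0 u≈sw (s′ , v≈s′w) = s′ * inv s s≉0 , λ i → begin
    v i                                ≈⟨ v≈s′w i ⟩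
    s′ * w i                           ≈⟨ *-identityˡ _ ⟨
    1# * (s′ * w i)                    ≈⟨ *-congʳ (inverseˡ s s≉0) ⟨
    (inv s s≉0 * s) * (s′ * w i)       ≈⟨ solve 4 (λ s⁻¹ s s′ w → (s⁻¹ :* s) :* (s′ :* w) := (s′ :* s⁻¹) :* (s :* w))
                                            refl (inv s s≉0) s s′ (w i) ⟩
    (s′ * inv s s≉0) * (s * w i)       ≈⟨ *-congˡ (u≈sw i) ⟨
    (s′ * inv s s≉0) * u i             ∎

  J-multiple⇒multiple : ∀ {x y : V} {k} → J y ≈V (k ⊛ J x) → y ≈V (τ k ⊛ x)
  J-multiple⇒multiple {x} {y} {k} Jy≈kJx j = begin
    y j              ≈⟨ τ-involutive (y j) ⟨
    τ (τ (y j))      ≈⟨ τ.⟦⟧-cong (τy≈kτx j) ⟩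
    τ (k * τ (x j))  ≈⟨ τ.*-homo _ _ ⟩
    τ k * τ (τ (x j)) ≈⟨ *-congˡ (τ-involutive (x j)) ⟩
    τ k * x j        ∎
    where
    τy≈kτx : ∀ j → τ (y j) ≈ k * τ (x j)
    τy≈kτx 0F = Jy≈kJx i2
    τy≈kτx 1F = Jy≈kJx i1
    τy≈kτx 2F = Jy≈kJx i0

  -- the form has Witt index one
  isotropic-orthogonal⇒SameLine : ∀ {x y : V} → NonZeroV x → H x x ≈ 0# → NonZeroV y → H y y ≈ 0# →
                                  H y x ≈ 0# → SameLine x y
  isotropic-orthogonal⇒SameLine {x} {y} x≉0 Hxx≈0 y≉0 Hyy≈0 Hyx≈0 with zero⊎nonzero-coordinate (cross x y)
  ... | inj₁ x×y≈0 = let (s , y≈sx) = cross≈0⇒∈⟨⟩ x≉0 x×y≈0 in s , multiple-coefficient≉0 y≉0 y≈sx , y≈sx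
  ... | inj₂ (i , x×yᵢ≉0) = τ k , multiple-coefficient≉0 y≉0 y≈τkx , y≈τkx
    where
    x×y≉0 : NonZeroV (cross x y)
    x×y≉0 x×y≈0 = x×yᵢ≉0 (x×y≈0 i)
    Jx∈ : J x ∈⟨ cross x y ⟩
    Jx∈ = dot-orthogonal⇒∈⟨cross⟩ x×y≉0 (trans (dot-comm (J x) x) Hxx≈0) (trans (dot-comm (J x) y) Hyx≈0)
    Jy∈ : J y ∈⟨ cross x y ⟩
    Jy∈ = dot-orthogonal⇒∈⟨cross⟩ x×y≉0 (trans (dot-comm (J y) x) (H≈0-sym y x Hyx≈0)) (trans (dot-comm (J y) y) Hyy≈0)
    Jx≉0 : NonZeroV (J x)
    Jx≉0 Jx≈0 = x≉0 λ { 0F → τx≈0⇒x≈0 (Jx≈0 i2)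
                      ; 1F → τx≈0⇒x≈0 (Jx≈0 i1)
                      ; 2F → τx≈0⇒x≈0 (Jx≈0 i0) }
    Jy∈⟨Jx⟩ : J y ∈⟨ J x ⟩
    Jy∈⟨Jx⟩ = ∈⟨⟩-rebase (multiple-coefficient≉0 Jx≉0 (proj₂ Jx∈)) (proj₂ Jx∈) Jy∈
    k = proj₁ Jy∈⟨Jx⟩
    y≈τkx : y ≈V (τ k ⊛ x)
    y≈τkx = J-multiple⇒multiple (proj₂ Jy∈⟨Jx⟩)

  orthogonal-to-hyperbolic-pair⇒∈⟨⟩ : ∀ {x y u v : V} → H x x ≈ 0# → H y y ≈ 0# → H y x ≈ 1# →
    H u x ≈ 0# → H u y ≈ 0# → H v x ≈ 0# → H v y ≈ 0# → NonZeroV v → u ∈⟨ v ⟩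
  orthogonal-to-hyperbolic-pair⇒∈⟨⟩ {x} {y} {u} {v} Hxx≈0 Hyy≈0 Hyx≈1 Hux≈0 Huy≈0 Hvx≈0 Hvy≈0 v≉0 =
    ∈⟨⟩-rebase (multiple-coefficient≉0 v≉0 (proj₂ v∈)) (proj₂ v∈) u∈
    where
    w = cross (J x) (J y)
    w≉0 : NonZeroV w
    w≉0 w≈0 = 1≉0 (begin
      1#                                 ≈⟨ -‿involutive 1# ⟨
      - - 1#                             ≈⟨ -‿cong -1≈0 ⟩
      - 0#                               ≈⟨ -0#≈0# ⟩
      0#                                 ∎)
      where
      -1≈0 : - 1# ≈ 0#
      -1≈0 = begin
        - 1#                               ≈⟨ +-identityˡ _ ⟨
        0# - 1#                            ≈⟨ +-cong (sym (zeroˡ 0#)) (-‿cong (sym (*-identityˡ 1#))) ⟩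
        0# * 0# - 1# * 1#                  ≈⟨ +-cong (*-cong (sym Hxx≈0) (sym Hyy≈0)) (-‿cong (*-cong (sym (H≈1-sym y x Hyx≈1)) (sym Hyx≈1))) ⟩
        H x x * H y y - H x y * H y x      ≈⟨ dot-cross x y (J x) (J y) ⟨
        dot (cross x y) w                  ≈⟨ dot-zeroʳ (cross x y) w≈0 ⟩
        0#                                 ∎
    u∈ : u ∈⟨ w ⟩
    u∈ = dot-orthogonal⇒∈⟨cross⟩ w≉0 Hux≈0 Huy≈0
    v∈ : v ∈⟨ w ⟩
    v∈ = dot-orthogonal⇒∈⟨cross⟩ w≉0 Hvx≈0 Hvy≈0

  Tr : Carrier → Carrier
  Tr x = x + τ x

  H-expand : ∀ u v → H (u ⊕ v) (u ⊕ v) ≈ (H u u + H u v) + (H v u + H v v)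
  H-expand u v = trans (H-distribʳ-⊕ u v (u ⊕ v)) (+-cong (H-distribˡ-⊕ u u v) (H-distribˡ-⊕ v u v))

  H-⊛⊛ : ∀ k u → H (k ⊛ u) (k ⊛ u) ≈ (k * τ k) * H u u
  H-⊛⊛ k u = trans (H-⊛ˡ k u (k ⊛ u)) (trans (*-congˡ (H-⊛ʳ k u u)) (sym (*-assoc _ _ _)))

  H-orthogonal-sum : ∀ u v → H u v ≈ 0# → H v u ≈ 0# → H (u ⊕ v) (u ⊕ v) ≈ H u u + H v v
  H-orthogonal-sum u v Huv≈0 Hvu≈0 = begin
    H (u ⊕ v) (u ⊕ v)                    ≈⟨ H-expand u v ⟩
    (H u u + H u v) + (H v u + H v v)    ≈⟨ +-cong (+-congˡ Huv≈0) (+-congʳ Hvu≈0) ⟩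
    (H u u + 0#) + (0# + H v v)          ≈⟨ +-cong (+-identityʳ _) (+-identityˡ _) ⟩
    H u u + H v v                        ∎

  H-shift-isotropic : ∀ x u μ → H x x ≈ 0# → H u x ≈ 1# → H (u ⊕ μ ⊛ x) (u ⊕ μ ⊛ x) ≈ H u u + Tr μ
  H-shift-isotropic x u μ Hxx≈0 Hux≈1 = begin
    H (u ⊕ μ ⊛ x) (u ⊕ μ ⊛ x)                                ≈⟨ H-expand u (μ ⊛ x) ⟩
    (H u u + H u (μ ⊛ x)) + (H (μ ⊛ x) u + H (μ ⊛ x) (μ ⊛ x))  ≈⟨ +-cong (+-congˡ (H-⊛ʳ μ u x)) (+-cong (H-⊛ˡ μ x u) (H-⊛⊛ μ x)) ⟩
    (H u u + τ μ * H u x) + (μ * H x u + (μ * τ μ) * H x x)    ≈⟨ +-cong (+-congˡ (*-congˡ Hux≈1)) (+-cong (*-congˡ (H≈1-sym u x Hux≈1)) (*-congˡ Hxx≈0)) ⟩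
    (H u u + τ μ * 1#) + (μ * 1# + (μ * τ μ) * 0#)             ≈⟨ +-cong (+-congˡ (*-identityʳ _)) (trans (+-cong (*-identityʳ μ) (zeroʳ _)) (+-identityʳ μ)) ⟩
    (H u u + τ μ) + μ                                          ≈⟨ solve 3 (λ h μ τμ → (h :+ τμ) :+ μ := h :+ (μ :+ τμ)) refl (H u u) μ (τ μ) ⟩
    H u u + Tr μ                                               ∎

  SameLine-⊛ : ∀ {y z : V} {k k′} → k ≉ 0# → k′ ≉ 0# → SameLine (k ⊛ y) (k′ ⊛ z) → SameLine y z
  SameLine-⊛ {y} {z} {k} {k′} k≉0 k′≉0 (m , m≉0 , k′z≈mky) =
    s , x≉0∧y≉0⇒x*y≉0 (inv≉0 k′ k′≉0) (x≉0∧y≉0⇒x*y≉0 m≉0 k≉0) , λ i → begin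
      z i                          ≈⟨ *-identityˡ _ ⟨
      1# * z i                     ≈⟨ *-congʳ (inverseˡ k′ k′≉0) ⟨
      (inv k′ k′≉0 * k′) * z i     ≈⟨ *-assoc _ _ _ ⟩
      inv k′ k′≉0 * (k′ * z i)     ≈⟨ *-congˡ (k′z≈mky i) ⟩
      inv k′ k′≉0 * (m * (k * y i)) ≈⟨ solve 4 (λ k′⁻¹ m k y → k′⁻¹ :* (m :* (k :* y)) := (k′⁻¹ :* (m :* k)) :* y)
                                        refl (inv k′ k′≉0) m k (y i) ⟩
      s * y i                      ∎
    where s = inv k′ k′≉0 * (m * k)

  ≈V⇒SameLine : ∀ {u v : V} → u ≈V v → SameLine u v
  ≈V⇒SameLine u≈v = 1# , 1≉0 , λ i → trans (sym (u≈v i)) (sym (*-identityˡ _))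

module GaloisField {c ℓ} (p f : ℕ) (p-prime : Prime p) (R : CommutativeRing c ℓ)
                   (F : IsFiniteFieldOfSize R ((p ℕ.^ f) ℕ.^ 2)) where
  open CommutativeRing R
  open Unitary R
  open CommutativeRingProperties R
  open IsFiniteFieldOfSize F using (_≟_)
  open FiniteField R F public
  open IntegerCoefficientSolver R using (solve; _:+_; _:*_; _:-_; :-_; _:=_)
  open import Algebra.Properties.Semiring.Mult semiring using () renaming (_×_ to _×ₙ_)
  open import Relation.Binary.Reasoning.Setoid setoid

  q : ℕ
  q = p ℕ.^ f

  p≈0 : p ×ₙ 1# ≈ 0#
  p≈0 = x^ᶠn≈0⇒x≈0 f (x^ᶠn≈0⇒x≈0 2 (begin
    ((p ×ₙ 1#) ^ᶠ f) ^ᶠ 2   ≈⟨ ^ᶠ-congˡ 2 (×1-homo-^ p f) ⟨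
    (q ×ₙ 1#) ^ᶠ 2          ≈⟨ ×1-homo-^ q 2 ⟨
    (q ℕ.^ 2) ×ₙ 1#         ≈⟨ characteristic ⟩
    0#                      ∎))

  open PrimeSubfield p-prime p≈0 public

  τ-involutive : ∀ x → (x ^ᶠ q) ^ᶠ q ≈ x
  τ-involutive x = trans (^ᶠ-assocʳ x q q) (trans (reflexive (≡.cong (λ k → x ^ᶠ (q ℕ.* k)) (≡.sym (ℕ.*-identityʳ q)))) (fermat x))

  τ-isRingHomomorphism : IsRingHomomorphism (_^ᶠ q)
  τ-isRingHomomorphism = ^ᶠ-isRingHomomorphism q (frobenius-^ p-prime p≈0 f)

  open HermitianForm R F q τ-isRingHomomorphism τ-involutive public

  σ : Carrier → Carrier
  σ x = x ^ᶠ p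

  H-σ : ∀ u v → H (powV p u) (powV p v) ≈ σ (H u v)
  H-σ u v = sym (begin
    σ (H u v)
      ≈⟨ trans (σ.+-homo _ _) (+-congˡ (σ.+-homo _ _)) ⟩
    σ (u i0 * τ (v i2)) + (σ (u i1 * τ (v i1)) + σ (u i2 * τ (v i0)))
      ≈⟨ +-cong (σ.*-homo _ _) (+-cong (σ.*-homo _ _) (σ.*-homo _ _)) ⟩
    σ (u i0) * σ (τ (v i2)) + (σ (u i1) * σ (τ (v i1)) + σ (u i2) * σ (τ (v i0)))
      ≈⟨ +-cong (*-congˡ (^ᶠ-comm _ q p)) (+-cong (*-congˡ (^ᶠ-comm _ q p)) (*-congˡ (^ᶠ-comm _ q p))) ⟩
    H (powV p u) (powV p v)
      ∎)

  module FixedPoints (A : Mat) (unitary : IsUnitary q A) where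

    -- σ(u) = a (u A): ⟨u⟩ is a fixed point of g h⁻¹, where g is induced by A and h by σ
    Fix : Carrier → V → Set ℓ
    Fix a u = ∀ i → σ (u i) ≈ a * (u · A) i

    ·A-distrib-⊝ : ∀ u v j → ((u ⊝ v) · A) j ≈ (u · A) j - (v · A) j
    ·A-distrib-⊝ u v j = solve 9 (λ u₀ u₁ u₂ v₀ v₁ v₂ a₀ a₁ a₂ →
        (u₀ :- v₀) :* a₀ :+ ((u₁ :- v₁) :* a₁ :+ (u₂ :- v₂) :* a₂)
        := (u₀ :* a₀ :+ (u₁ :* a₁ :+ u₂ :* a₂)) :- (v₀ :* a₀ :+ (v₁ :* a₁ :+ v₂ :* a₂)))
      refl (u i0) (u i1) (u i2) (v i0) (v i1) (v i2) (A i0 j) (A i1 j) (A i2 j)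

    ·A-⊛ : ∀ k u j → ((k ⊛ u) · A) j ≈ k * (u · A) j
    ·A-⊛ k u j = solve 7 (λ k u₀ u₁ u₂ a₀ a₁ a₂ →
        (k :* u₀) :* a₀ :+ ((k :* u₁) :* a₁ :+ (k :* u₂) :* a₂) := k :* (u₀ :* a₀ :+ (u₁ :* a₁ :+ u₂ :* a₂)))
      refl k (u i0) (u i1) (u i2) (A i0 j) (A i1 j) (A i2 j)

    Fix-cong : ∀ {a a′ u} → a ≈ a′ → Fix a u → Fix a′ u
    Fix-cong a≈a′ fix i = trans (fix i) (*-congʳ a≈a′)

    Fix-⊝ : ∀ {a u v} → Fix a u → Fix a v → Fix a (u ⊝ v)
    Fix-⊝ {a} {u} {v} fixᵤ fixᵥ i = begin
      σ (u i - v i)                    ≈⟨ σ.-‿homo₂ _ _ ⟩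
      σ (u i) - σ (v i)                ≈⟨ +-cong (fixᵤ i) (-‿cong (fixᵥ i)) ⟩
      a * (u · A) i - a * (v · A) i    ≈⟨ solve 3 (λ a x y → a :* x :- a :* y := a :* (x :- y)) refl a _ _ ⟩
      a * ((u · A) i - (v · A) i)      ≈⟨ *-congˡ (·A-distrib-⊝ u v i) ⟨
      a * ((u ⊝ v) · A) i              ∎

    Fix-⊛ : ∀ {a u} k (k≉0 : k ≉ 0#) → Fix a u → Fix (σ k * (a * inv k k≉0)) (k ⊛ u)
    Fix-⊛ {a} {u} k k≉0 fix i = begin
      σ (k * u i)                                    ≈⟨ σ.*-homo _ _ ⟩
      σ k * σ (u i)                                  ≈⟨ *-congˡ (fix i) ⟩
      σ k * (a * (u · A) i)                          ≈⟨ *-congˡ (*-congˡ (*-identityˡ _)) ⟨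
      σ k * (a * (1# * (u · A) i))                   ≈⟨ *-congˡ (*-congˡ (*-congʳ (inverseˡ k k≉0))) ⟨
      σ k * (a * ((inv k k≉0 * k) * (u · A) i))      ≈⟨ solve 5 (λ s a k⁻¹ k x → s :* (a :* ((k⁻¹ :* k) :* x)) := (s :* (a :* k⁻¹)) :* (k :* x))
                                                          refl (σ k) a (inv k k≉0) k _ ⟩
      (σ k * (a * inv k k≉0)) * (k * (u · A) i)      ≈⟨ *-congˡ (·A-⊛ k u i) ⟨
      (σ k * (a * inv k k≉0)) * ((k ⊛ u) · A) i      ∎

    H-Fix : ∀ {a b u v} → Fix a u → Fix b v → σ (H u v) ≈ (a * τ b) * H u v
    H-Fix {a} {b} {u} {v} fixᵤ fixᵥ = begin
      σ (H u v)                          ≈⟨ H-σ u v ⟨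
      H (powV p u) (powV p v)            ≈⟨ H-cong fixᵤ fixᵥ ⟩
      H (a ⊛ (u · A)) (b ⊛ (v · A))      ≈⟨ H-⊛ˡ a (u · A) (b ⊛ (v · A)) ⟩
      a * H (u · A) (b ⊛ (v · A))        ≈⟨ *-congˡ (H-⊛ʳ b (u · A) (v · A)) ⟩
      a * (τ b * H (u · A) (v · A))      ≈⟨ *-congˡ (*-congˡ (unitary u v)) ⟩
      a * (τ b * H u v)                  ≈⟨ *-assoc _ _ _ ⟨
      (a * τ b) * H u v                  ∎

    FixedPoint : V → Set (c ⊔ ℓ)
    FixedPoint y = IsotropicPoint q y × SameLine (y · A) (powV p y)

    module Normalisation {x b} (x≉0 : NonZeroV x) (Hxx≈0 : H x x ≈ 0#) (b≉0 : b ≉ 0#) (fixₓ : Fix b x) where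

      τb≉0 : τ b ≉ 0#
      τb≉0 = x^ᶠn≉0 q b≉0

      a : Carrier
      a = inv (τ b) τb≉0

      κ : Carrier
      κ = a * τ a

      Fix⇒≈a : ∀ {a′ u} → Fix a′ u → H u x ≈ 1# → a′ ≈ a
      Fix⇒≈a {a′} {u} fixᵤ Hux≈1 = *-cancelʳ τb≉0 (begin
        a′ * τ b                ≈⟨ *-identityʳ _ ⟨
        (a′ * τ b) * 1#         ≈⟨ *-congˡ Hux≈1 ⟨
        (a′ * τ b) * H u x      ≈⟨ H-Fix fixᵤ fixₓ ⟨
        σ (H u x)               ≈⟨ σ.⟦⟧-cong Hux≈1 ⟩
        σ 1#                    ≈⟨ σ.1#-homo ⟩
        1#                      ≈⟨ inverseˡ (τ b) τb≉0 ⟨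
        a * τ b                 ∎)

      record Normalised (y : V) : Set ℓ where
        field
          nonzero   : NonZeroV y
          isotropic : H y y ≈ 0#
          H-x≈1     : H y x ≈ 1#
          fixed     : Fix a y

      open Normalised

      σH≈κH : ∀ {y z} → Normalised y → Normalised z → σ (H y z) ≈ κ * H y z
      σH≈κH Ny Nz = H-Fix (fixed Ny) (fixed Nz)

      -- junk value 1 when H y x ≈ 0
      scale : V → Carrier
      scale y with H y x ≟ 0#
      ... | yes _    = 1#
      ... | no Hyx≉0 = inv (H y x) Hyx≉0

      scale≉0 : ∀ y → scale y ≉ 0#
      scale≉0 y with H y x ≟ 0#
      ... | yes _    = 1≉0
      ... | no Hyx≉0 = inv≉0 (H y x) Hyx≉0

      scale*H≈1 : ∀ y → H y x ≉ 0# → scale y * H y x ≈ 1#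
      scale*H≈1 y Hyx≉0 with H y x ≟ 0#
      ... | yes Hyx≈0 = ⊥-elim (Hyx≉0 Hyx≈0)
      ... | no Hyx≉0  = inverseˡ (H y x) Hyx≉0

      normalise : V → V
      normalise y = scale y ⊛ y

      normalise-Normalised : ∀ {y} → ¬ SameLine x y → FixedPoint y → Normalised (normalise y)
      normalise-Normalised {y} x≁y ((y≉0 , Hyy≈0) , (a′ , _ , fixᵧ)) = record
        { nonzero   = λ ky≈0 → y≉0 (λ i → *-cancelˡ (scale≉0 y) (trans (ky≈0 i) (sym (zeroʳ _))))
        ; isotropic = trans (H-⊛⊛ (scale y) y) (trans (*-congˡ Hyy≈0) (zeroʳ _))
        ; H-x≈1     = H-ky-x≈1
        ; fixed     = Fix-cong (Fix⇒≈a fixₖᵧ H-ky-x≈1) fixₖᵧ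
        }
        where
        Hyx≉0 : H y x ≉ 0#
        Hyx≉0 Hyx≈0 = x≁y (isotropic-orthogonal⇒SameLine x≉0 Hxx≈0 y≉0 Hyy≈0 Hyx≈0)
        H-ky-x≈1 : H (normalise y) x ≈ 1#
        H-ky-x≈1 = trans (H-⊛ˡ (scale y) y x) (scale*H≈1 y Hyx≉0)
        fixₖᵧ = Fix-⊛ (scale y) (scale≉0 y) fixᵧ

      eigenvalue-bound : ∀ (g : V → Carrier) {l} → AllPairs (λ u v → g u ≉ g v) l →
                         All (λ u → σ (g u) ≈ κ * g u) l → length l ≤ p
      eigenvalue-bound g {l} distinct eigen = ≡.subst (_≤ p) (length-map g l)
        (length-roots[x^m-κx]≤m κ (map g l) 2≤p (AllPairs.map⁺ distinct) (All.map⁺ eigen))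

      module DoubleCollision {y₀ y z} (N₀ : Normalised y₀) (Ny : Normalised y) (Nz : Normalised z)
                             (y≁z : ¬ SameLine y z) (αy≈αz : H y y₀ ≈ H z y₀) where

        α : V → Carrier
        α w = H w y₀

        Hxy₀≈1 : H x y₀ ≈ 1#
        Hxy₀≈1 = H≈1-sym y₀ x (H-x≈1 N₀)

        d : V
        d = y ⊝ z

        Hdx≈0 : H d x ≈ 0#
        Hdx≈0 = trans (H-distribʳ-⊝ y z x) (x≈y⇒x-y≈0 (trans (H-x≈1 Ny) (sym (H-x≈1 Nz))))

        Hdy₀≈0 : H d y₀ ≈ 0#
        Hdy₀≈0 = trans (H-distribʳ-⊝ y z y₀) (x≈y⇒x-y≈0 αy≈αz)

        d-fixed : Fix a d
        d-fixed = Fix-⊝ (fixed Ny) (fixed Nz)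

        d≉0 : NonZeroV d
        d≉0 d≈0 = y≁z (≈V⇒SameLine (λ i → x-y≈0⇒x≈y (d≈0 i)))

        Hdd≉0 : H d d ≉ 0#
        Hdd≉0 Hdd≈0 = μ≉0 (begin
          μ               ≈⟨ *-identityʳ μ ⟨
          μ * 1#          ≈⟨ *-congˡ Hxy₀≈1 ⟨
          μ * H x y₀      ≈⟨ H-⊛ˡ μ x y₀ ⟨
          H (μ ⊛ x) y₀    ≈⟨ H-congˡ y₀ (≈V-sym d≈μx) ⟩
          H d y₀          ≈⟨ Hdy₀≈0 ⟩
          0#              ∎)
          where
          x∥d = isotropic-orthogonal⇒SameLine x≉0 Hxx≈0 d≉0 Hdd≈0 Hdx≈0
          μ = proj₁ x∥d
          μ≉0 = proj₁ (proj₂ x∥d)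
          d≈μx : d ≈V (μ ⊛ x)
          d≈μx = proj₂ (proj₂ x∥d)

        base : Carrier → V
        base t = y₀ ⊕ t ⊛ x

        H-base : ∀ t v → H (base t) v ≈ H y₀ v + t * H x v
        H-base t v = trans (H-distribʳ-⊕ y₀ (t ⊛ x) v) (+-congˡ (H-⊛ˡ t x v))

        H-base-d : ∀ t → H (base t) d ≈ 0#
        H-base-d t = begin
          H (base t) d           ≈⟨ H-base t d ⟩
          H y₀ d + t * H x d     ≈⟨ +-cong (H≈0-sym d y₀ Hdy₀≈0) (*-congˡ (H≈0-sym d x Hdx≈0)) ⟩
          0# + t * 0#            ≈⟨ trans (+-identityˡ _) (zeroʳ t) ⟩
          0#                     ∎

        residual-x : ∀ {w} → Normalised w → H (w ⊝ base (α w)) x ≈ 0#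
        residual-x {w} Nw = trans (H-distribʳ-⊝ w (base (α w)) x) (x≈y⇒x-y≈0 (begin
          H w x                      ≈⟨ H-x≈1 Nw ⟩
          1#                         ≈⟨ H-x≈1 N₀ ⟨
          H y₀ x                     ≈⟨ +-identityʳ _ ⟨
          H y₀ x + 0#                ≈⟨ +-congˡ (trans (*-congˡ Hxx≈0) (zeroʳ _)) ⟨
          H y₀ x + α w * H x x       ≈⟨ H-base (α w) x ⟨
          H (base (α w)) x           ∎))

        residual-y₀ : ∀ w → H (w ⊝ base (α w)) y₀ ≈ 0#
        residual-y₀ w = trans (H-distribʳ-⊝ w (base (α w)) y₀) (x≈y⇒x-y≈0 (begin
          α w                        ≈⟨ +-identityˡ _ ⟨
          0# + α w                   ≈⟨ +-cong (isotropic N₀) (*-identityʳ _) ⟨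
          H y₀ y₀ + α w * 1#         ≈⟨ +-congˡ (*-congˡ Hxy₀≈1) ⟨
          H y₀ y₀ + α w * H x y₀     ≈⟨ H-base (α w) y₀ ⟨
          H (base (α w)) y₀          ∎))

        -- x, y₀ is a hyperbolic pair and d spans its orthogonal complement
        residual∈⟨d⟩ : ∀ {w} → Normalised w → (w ⊝ base (α w)) ∈⟨ d ⟩
        residual∈⟨d⟩ {w} Nw = orthogonal-to-hyperbolic-pair⇒∈⟨⟩ {x = x} {y = y₀} Hxx≈0 (isotropic N₀) (H-x≈1 N₀)
                                (residual-x Nw) (residual-y₀ w) Hdx≈0 Hdy₀≈0 d≉0

        coefficient : ∀ {w} → Normalised w → Carrier
        coefficient Nw = proj₁ (residual∈⟨d⟩ Nw)

        decompose : ∀ {w} (Nw : Normalised w) → w ≈V ((coefficient Nw ⊛ d) ⊕ base (α w))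
        decompose {w} Nw i = begin
          w i                                       ≈⟨ solve 2 (λ w b → w := (w :- b) :+ b) refl (w i) (base (α w) i) ⟩
          (w i - base (α w) i) + base (α w) i       ≈⟨ +-congʳ (proj₂ (residual∈⟨d⟩ Nw) i) ⟩
          ((coefficient Nw ⊛ d) ⊕ base (α w)) i     ∎

        H-Normalised-d : ∀ {w} (Nw : Normalised w) → H w d ≈ coefficient Nw * H d d
        H-Normalised-d {w} Nw = begin
          H w d                                                     ≈⟨ H-congˡ d (decompose Nw) ⟩
          H ((coefficient Nw ⊛ d) ⊕ base (α w)) d                   ≈⟨ H-distribʳ-⊕ (coefficient Nw ⊛ d) (base (α w)) d ⟩
          H (coefficient Nw ⊛ d) d + H (base (α w)) d               ≈⟨ +-cong (H-⊛ˡ (coefficient Nw) d d) (H-base-d (α w)) ⟩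
          coefficient Nw * H d d + 0#                               ≈⟨ +-identityʳ _ ⟩
          coefficient Nw * H d d                                    ∎

        norm-Normalised : ∀ {w} (Nw : Normalised w) → (coefficient Nw * τ (coefficient Nw)) * H d d + Tr (α w) ≈ 0#
        norm-Normalised {w} Nw = begin
          (γ * τ γ) * H d d + Tr (α w)                      ≈⟨ +-cong (H-⊛⊛ γ d) H-base-base ⟨
          H (γ ⊛ d) (γ ⊛ d) + H (base (α w)) (base (α w))     ≈⟨ H-orthogonal-sum (γ ⊛ d) (base (α w)) Hγd-base H-base-d′ ⟨
          H ((γ ⊛ d) ⊕ base (α w)) ((γ ⊛ d) ⊕ base (α w))     ≈⟨ H-cong (decompose Nw) (decompose Nw) ⟨
          H w w                                                     ≈⟨ isotropic Nw ⟩
          0#                                                        ∎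
          where
          γ = coefficient Nw
          H-base-d′ : H (base (α w)) (γ ⊛ d) ≈ 0#
          H-base-d′ = trans (H-⊛ʳ γ (base (α w)) d) (trans (*-congˡ (H-base-d (α w))) (zeroʳ _))
          Hγd-base : H (γ ⊛ d) (base (α w)) ≈ 0#
          Hγd-base = H≈0-sym (base (α w)) (γ ⊛ d) H-base-d′
          H-base-base : H (base (α w)) (base (α w)) ≈ Tr (α w)
          H-base-base = trans (H-shift-isotropic x y₀ (α w) Hxx≈0 (H-x≈1 N₀)) (trans (+-congʳ (isotropic N₀)) (+-identityˡ _))

        Tr≈0⇒coefficient≈0 : ∀ {w} (Nw : Normalised w) → Tr (α w) ≈ 0# → coefficient Nw ≈ 0#
        Tr≈0⇒coefficient≈0 {w} Nw Trαw≈0 =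
          [ [ id , τx≈0⇒x≈0 ]′ ∘ x*y≈0⇒x≈0⊎y≈0 , ⊥-elim ∘ Hdd≉0 ]′ (x*y≈0⇒x≈0⊎y≈0 (begin
            (γ * τ γ) * H d d                        ≈⟨ +-identityʳ _ ⟨
            (γ * τ γ) * H d d + 0#                   ≈⟨ +-congˡ Trαw≈0 ⟨
            (γ * τ γ) * H d d + Tr (α w)             ≈⟨ norm-Normalised Nw ⟩
            0#                                       ∎))
          where γ = coefficient Nw

        Tr-multiple : ∀ k μ → Tr (k ×ₙ 1# * μ) ≈ k ×ₙ 1# * Tr μ
        Tr-multiple k μ = begin
          k ×ₙ 1# * μ + τ (k ×ₙ 1# * μ)          ≈⟨ +-congˡ (trans (τ.*-homo _ _) (*-congʳ (τ.×1-homo k))) ⟩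
          k ×ₙ 1# * μ + k ×ₙ 1# * τ μ            ≈⟨ distribˡ _ _ _ ⟨
          k ×ₙ 1# * Tr μ                         ∎

        collision⇒⊥ : ∀ {w w′} → Normalised w → Normalised w′ → ¬ SameLine w w′ → H w d ≈ H w′ d → ⊥
        collision⇒⊥ {w} {w′} Nw Nw′ w≁w′ Hwd≈Hw′d = y≁z (≈V⇒SameLine y≈z)
          where
          μ = α w - α w′

          w≈w′+μx : w ≈V (w′ ⊕ μ ⊛ x)
          w≈w′+μx i = begin
            w i                                               ≈⟨ decompose Nw i ⟩
            coefficient Nw * d i + (y₀ i + α w * x i)         ≈⟨ +-congʳ (*-congʳ same-coefficient) ⟩
            coefficient Nw′ * d i + (y₀ i + α w * x i)        ≈⟨ solve 6 (λ g d y a a′ x → g :* d :+ (y :+ a :* x) := (g :* d :+ (y :+ a′ :* x)) :+ (a :- a′) :* x)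
                                                                   refl (coefficient Nw′) (d i) (y₀ i) (α w) (α w′) (x i) ⟩
            (coefficient Nw′ * d i + (y₀ i + α w′ * x i)) + μ * x i ≈⟨ +-congʳ (decompose Nw′ i) ⟨
            w′ i + μ * x i                                    ∎
            where
            same-coefficient : coefficient Nw ≈ coefficient Nw′
            same-coefficient = *-cancelʳ Hdd≉0 (trans (sym (H-Normalised-d Nw)) (trans Hwd≈Hw′d (H-Normalised-d Nw′)))

          μ≉0 : μ ≉ 0#
          μ≉0 μ≈0 = w≁w′ (≈V⇒SameLine λ i → trans (w≈w′+μx i) (trans (+-congˡ (trans (*-congʳ μ≈0) (zeroˡ _))) (+-identityʳ _)))

          Trμ≈0 : Tr μ ≈ 0#
          Trμ≈0 = begin
            Tr μ                                ≈⟨ +-identityˡ _ ⟨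
            0# + Tr μ                           ≈⟨ +-congʳ (isotropic Nw′) ⟨
            H w′ w′ + Tr μ                      ≈⟨ H-shift-isotropic x w′ μ Hxx≈0 (H-x≈1 Nw′) ⟨
            H (w′ ⊕ μ ⊛ x) (w′ ⊕ μ ⊛ x)         ≈⟨ H-cong w≈w′+μx w≈w′+μx ⟨
            H w w                               ≈⟨ isotropic Nw ⟩
            0#                                  ∎

          σμ≈κμ : σ μ ≈ κ * μ
          σμ≈κμ = begin
            σ (α w - α w′)              ≈⟨ σ.-‿homo₂ _ _ ⟩
            σ (α w) - σ (α w′)          ≈⟨ +-cong (σH≈κH Nw N₀) (-‿cong (σH≈κH Nw′ N₀)) ⟩
            κ * α w - κ * α w′          ≈⟨ solve 3 (λ k a b → k :* a :- k :* b := k :* (a :- b)) refl κ (α w) (α w′) ⟩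
            κ * μ                       ∎

          -- every α v lies in 𝔽ₚ μ, so it has trace zero
          Tr-α≈0 : ∀ {v} → Normalised v → Tr (α v) ≈ 0#
          Tr-α≈0 {v} Nv = begin
            Tr (α v)                 ≈⟨ +-cong αv≈kμ (τ.⟦⟧-cong αv≈kμ) ⟩
            Tr (k ×ₙ 1# * μ)         ≈⟨ Tr-multiple k μ ⟩
            k ×ₙ 1# * Tr μ           ≈⟨ *-congˡ Trμ≈0 ⟩
            k ×ₙ 1# * 0#             ≈⟨ zeroʳ _ ⟩
            0#                       ∎
            where
            k = proj₁ (eigenvector⇒prime-multiple μ≉0 σμ≈κμ (σH≈κH Nv N₀))
            αv≈kμ = proj₂ (eigenvector⇒prime-multiple μ≉0 σμ≈κμ (σH≈κH Nv N₀))

          y≈z : y ≈V z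
          y≈z i = begin
            y i                                            ≈⟨ decompose Ny i ⟩
            coefficient Ny * d i + (y₀ i + α y * x i)      ≈⟨ +-cong (*-congʳ (trans (Tr≈0⇒coefficient≈0 Ny (Tr-α≈0 Ny)) (sym (Tr≈0⇒coefficient≈0 Nz (Tr-α≈0 Nz)))))
                                                                     (+-congˡ (*-congʳ αy≈αz)) ⟩
            coefficient Nz * d i + (y₀ i + α z * x i)      ≈⟨ decompose Nz i ⟨
            z i                                            ∎

        length≤p : ∀ {l} → All Normalised l → AllPairs (λ u v → ¬ SameLine u v) l → length l ≤ p
        length≤p N ≁ with distinct⊎collision (λ u v → H u d ≟ H v d) N ≁
        ... | inj₁ distinct = eigenvalue-bound (λ w → H w d) distinct (All.map (λ Nw → H-Fix (fixed Nw) d-fixed) N)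
        ... | inj₂ (_ , _ , Nw , Nw′ , w≁w′ , Hwd≈Hw′d) = ⊥-elim (collision⇒⊥ Nw Nw′ w≁w′ Hwd≈Hw′d)

      normalised-bound : ∀ {l} → All Normalised l → AllPairs (λ u v → ¬ SameLine u v) l → length l ≤ p
      normalised-bound {[]} _ _ = z≤n
      normalised-bound {y₀ ∷ l} N@(N₀ ∷ _) ≁ with distinct⊎collision (λ u v → H u y₀ ≟ H v y₀) N ≁
      ... | inj₁ distinct = eigenvalue-bound (λ w → H w y₀) distinct (All.map (λ Nw → σH≈κH Nw N₀) N)
      ... | inj₂ (_ , _ , Ny , Nz , y≁z , αy≈αz) = DoubleCollision.length≤p N₀ Ny Nz y≁z αy≈αz N ≁

      remaining-bound : ∀ {l} → All (λ y → ¬ SameLine x y) l → All FixedPoint l →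
                        AllPairs (λ u v → ¬ SameLine u v) l → length l ≤ p
      remaining-bound {l} x≁l P ≁ = ≡.subst (_≤ p) (length-map normalise l) (normalised-bound normalised distinct)
        where
        normalised : All Normalised (map normalise l)
        normalised = All.map⁺ (All.zipWith (λ (x≁y , Py) → normalise-Normalised x≁y Py) (x≁l , P))
        distinct : AllPairs (λ u v → ¬ SameLine u v) (map normalise l)
        distinct = AllPairs.map⁺ (AllPairs.map (λ y≁z → y≁z ∘ SameLine-⊛ (scale≉0 _) (scale≉0 _)) ≁)

    fixed-points-bound : ∀ xs → All FixedPoint xs → AllPairs (λ x y → ¬ SameLine x y) xs → length xs ≤ p ℕ.+ 1
    fixed-points-bound []         _ _ = z≤n
    fixed-points-bound (x ∷ rest) (((x≉0 , Hxx≈0) , (b , b≉0 , fixₓ)) ∷ P) (x≁rest ∷ ≁rest) =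
      ≡.subst (suc (length rest) ≤_) (ℕ.+-comm 1 p) (s≤s (remaining-bound x≁rest P ≁rest))
      where open Normalisation x≉0 Hxx≈0 b≉0 fixₓ

open import Data.Nat using (_+_; _^_)

lemma2p2 : {c ℓ : Level} (p f : ℕ) → Prime p →
           (R : CommutativeRing c ℓ) → IsFiniteFieldOfSize R ((p ^ f) ^ 2) →
           let open Unitary R in
           (A : Mat) → IsUnitary (p ^ f) A →
           (xs : List V) →
           All (λ x → IsotropicPoint (p ^ f) x × SameLine (x · A) (powV p x)) xs →
           AllPairs (λ x y → ¬ SameLine x y) xs →
           length xs ≤ p + 1
lemma2p2 p f p-prime R F A unitary = GaloisField.FixedPoints.fixed-points-bound p f p-prime R F A unitary
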